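{- Let $n=p^\alpha$ with $\alpha\ge1$ and $p$ a prime with $p\equiv1\pmod4$, and let $\chi$ be the unique Dirichlet character modulo $n$ of order $2$. Then $$\left|\{x\in\mathbb{Z}_{p^\alpha}: p\nmid x,\ p\nmid 1-x^2,\ \chi(1-x^2)=1\}\right|=\frac{p^{\alpha-1}(p-5)}{2}.$$
   Context: Dirichlet characters modulo $n$ are regarded as functions on $\mathbb{Z}_n$ that vanish on non-units. -}

module Defs where

open import Data.Nat using (ℕ; _+_; _*_; _∸_; NonZero)
open import Data.Nat.DivMod using (_mod_)
open import Data.Nat.GCD using (gcd)
open import Data.Nat.Divisibility using (_∣_; _∣?_)
open import Data.Fin using (Fin; toℕ)
open import Data.Integer using (ℤ; +_; _≟_) renaming (_*_ to _*ℤ_)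
open import Data.List using (List; length; filter)
open import Data.List.Base using (allFin)
open import Data.Product using (_×_; ∃)
open import Relation.Nullary using (¬_; Dec)
open import Relation.Nullary.Decidable using (_×-dec_; ¬?)
open import Relation.Binary.PropositionalEquality using (_≡_; _≢_)

module _ (n : ℕ) {{_ : NonZero n}} where

  oneZ : Fin n
  oneZ = 1 mod n

  mulZ : Fin n → Fin n → Fin n
  mulZ a b = (toℕ a * toℕ b) mod n

  -- the residue 1 - x² in ℤ_n (computed as (n² + 1 - x²) mod n, no truncation since x < n)
  oneMinusSq : Fin n → Fin n
  oneMinusSq x = ((n * n + 1) ∸ (toℕ x * toℕ x)) mod n

  IsUnit : Fin n → Set
  IsUnit a = gcd (toℕ a) n ≡ 1

  -- A Dirichlet character modulo n, viewed as a function on ℤ_n vanishing on non-units.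
  -- (Values in ℤ: characters of order 2 are real, hence take values in {0, 1, -1}.)
  record IsDirichletCharacter (χ : Fin n → ℤ) : Set where
    field
      χ-one  : χ oneZ ≡ + 1
      χ-mul  : ∀ a b → χ (mulZ a b) ≡ χ a *ℤ χ b
      χ-zero : ∀ a → ¬ IsUnit a → χ a ≡ + 0

  record HasOrder2 (χ : Fin n → ℤ) : Set where
    field
      sq-principal  : ∀ a → IsUnit a → χ a *ℤ χ a ≡ + 1
      not-principal : ∃ λ a → IsUnit a × (χ a ≢ + 1)

  countSet : (p : ℕ) → (Fin n → ℤ) → ℕ
  countSet p χ = length (filter P? (allFin n))
    where
      P? : (x : Fin n) → Dec ((¬ (p ∣ toℕ x)) × ((¬ (p ∣ toℕ (oneMinusSq x))) × (χ (oneMinusSq x) ≡ + 1)))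
      P? x = ¬? (p ∣? toℕ x) ×-dec (¬? (p ∣? toℕ (oneMinusSq x)) ×-dec (χ (oneMinusSq x) ≟ + 1))

-- Write N = p^α.  Call u admissible if u, u² + 1 and u² − 1 are units mod N, i.e. u ≢ 0, ±1, ±i (mod p),
-- where i² ≡ −1; there are p^(α−1)(p − 5) admissible residues.  The map u ↦ x = (u + u⁻¹)/2 sends them into
-- the counted set, since 1 − x² = (i(u − u⁻¹)/2)² is the square of a unit and χ is trivial on squares.
-- Conversely every unit with χ = 1 is a square: multiplication by a non-residue swaps the two χ-classes of
-- units and squaring is 2-to-1 on units, so both sets have half of all units.  Writing 1 − x² = y², the
-- preimages of x are exactly the two residues x ± iy.  Finally, i exists because inversion pairs off the
-- unit squares other than ±1 while their number p^(α−1)(p − 1)/2 is even; so −1 must be a unit square.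

module Submission where

open import Data.Nat as ℕ using (ℕ; suc; NonZero)
open import Data.Nat.Primality using (Prime)
open import Data.Fin using (Fin)
open import Data.Integer using (ℤ)
open import Relation.Binary.PropositionalEquality using (_≡_)
open import Defs using (IsDirichletCharacter; HasOrder2)

module Counting where

  open import Data.Nat
  open import Data.Nat.Properties
  open import Data.Nat.DivMod using (_%_; m<n⇒m%n≡m; [m+n]%n≡m%n)
  open import Data.Fin as Fin using (Fin; toℕ; fromℕ<)
  open import Data.Fin.Properties using (toℕ-fromℕ<; toℕ<n; toℕ-injective)
  open import Data.Fin.Permutation using (Permutation; permutation)
  open import Data.List using (length; filter; tabulate; allFin)
  open import Data.Product using (Σ-syntax; _×_; _,_; proj₁; proj₂)
  open import Data.Sum using (_⊎_; [_,_]′)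
  open import Level using (Level)
  open import Relation.Nullary using (Dec; yes; no; ¬_; contradiction)
  open import Relation.Nullary.Decidable using (_×-dec_; ¬?)
  open import Relation.Unary using (Pred; Decidable)
  open import Relation.Binary using (tri<; tri≈; tri>)
  open import Relation.Binary.PropositionalEquality
  open import Function using (_∘_; id)
  open import Algebra.Properties.Semiring.Sum +-*-semiring
    using (sum; sum-cong-≗; ∑-distrib-+; ∑-comm; sum-permute; *-distribˡ-sum)

  private variable
    ℓ ℓ′ : Level
    A B : Set ℓ

  𝟙 : Dec A → ℕ
  𝟙 (yes _) = 1
  𝟙 (no _) = 0

  𝟙-yes : (d : Dec A) → A → 𝟙 d ≡ 1
  𝟙-yes (yes _) _ = refl
  𝟙-yes (no ¬a) a = contradiction a ¬a

  𝟙-no : (d : Dec A) → ¬ A → 𝟙 d ≡ 0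
  𝟙-no (yes a) ¬a = contradiction a ¬a
  𝟙-no (no _) _ = refl

  𝟙-cong : (d : Dec A) (e : Dec B) → (A → B) → (B → A) → 𝟙 d ≡ 𝟙 e
  𝟙-cong (yes a) e to from = sym (𝟙-yes e (to a))
  𝟙-cong (no ¬a) e to from = sym (𝟙-no e (λ b → ¬a (from b)))

  𝟙-mono : (d : Dec A) (e : Dec B) → (A → B) → 𝟙 d ≤ 𝟙 e
  𝟙-mono (yes a) e A⇒B = ≤-reflexive (sym (𝟙-yes e (A⇒B a)))
  𝟙-mono (no _) e A⇒B = z≤n

  𝟙≡1⇒ : (d : Dec A) → 𝟙 d ≡ 1 → A
  𝟙≡1⇒ (yes a) _ = a

  𝟙-yes-×-dec : (a : A) (e : Dec B) → 𝟙 (yes a ×-dec e) ≡ 𝟙 e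
  𝟙-yes-×-dec a (yes _) = refl
  𝟙-yes-×-dec a (no _) = refl

  𝟙-trichotomy-< : ∀ x y → 1 ≡ 𝟙 (y ≟ x) + 𝟙 (x <? y) + 𝟙 (y <? x)
  𝟙-trichotomy-< x y with <-cmp x y
  ... | tri< x<y x≢y y≮x = sym (cong₂ _+_ (cong₂ _+_ (𝟙-no (y ≟ x) (x≢y ∘ sym)) (𝟙-yes (x <? y) x<y)) (𝟙-no (y <? x) y≮x))
  ... | tri≈ x≮y x≡y y≮x = sym (cong₂ _+_ (cong₂ _+_ (𝟙-yes (y ≟ x) (sym x≡y)) (𝟙-no (x <? y) x≮y)) (𝟙-no (y <? x) y≮x))
  ... | tri> x≮y x≢y y<x = sym (cong₂ _+_ (cong₂ _+_ (𝟙-no (y ≟ x) (x≢y ∘ sym)) (𝟙-no (x <? y) x≮y)) (𝟙-yes (y <? x) y<x))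

  ∑< : ℕ → (ℕ → ℕ) → ℕ
  ∑< n f = sum {n} (λ i → f (toℕ i))

  ∑<-cong : ∀ n {f g : ℕ → ℕ} → (∀ x → x < n → f x ≡ g x) → ∑< n f ≡ ∑< n g
  ∑<-cong n f≡g = sum-cong-≗ (λ i → f≡g (toℕ i) (toℕ<n i))

  ∑<-+ : ∀ n (f g : ℕ → ℕ) → ∑< n (λ x → f x + g x) ≡ ∑< n f + ∑< n g
  ∑<-+ n f g = ∑-distrib-+ {n} (λ i → f (toℕ i)) (λ i → g (toℕ i))

  ∑<-*ˡ : ∀ n c (f : ℕ → ℕ) → ∑< n (λ x → c * f x) ≡ c * ∑< n f
  ∑<-*ˡ n c f = sym (*-distribˡ-sum {n} c (λ i → f (toℕ i)))

  ∑<-swap : ∀ m n (f : ℕ → ℕ → ℕ) → ∑< m (λ x → ∑< n (f x)) ≡ ∑< n (λ y → ∑< m (λ x → f x y))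
  ∑<-swap m n f = ∑-comm {m} {n} (λ i j → f (toℕ i) (toℕ j))

  ∑<-zero : ∀ n → ∑< n (λ _ → 0) ≡ 0
  ∑<-zero zero = refl
  ∑<-zero (suc n) = ∑<-zero n

  ∑<-one : ∀ n → ∑< n (λ _ → 1) ≡ n
  ∑<-one zero = refl
  ∑<-one (suc n) = cong suc (∑<-one n)

  ∑<-++ : ∀ m n (f : ℕ → ℕ) → ∑< (m + n) f ≡ ∑< m f + ∑< n (λ x → f (m + x))
  ∑<-++ zero n f = refl
  ∑<-++ (suc m) n f = trans (cong (f 0 +_) (∑<-++ m n (λ x → f (suc x)))) (sym (+-assoc (f 0) _ _))

  ∑<-periodic : ∀ p .{{_ : NonZero p}} m (f : ℕ → ℕ) → ∑< (p * m) (λ x → f (x % p)) ≡ m * ∑< p f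
  ∑<-periodic p zero f = cong (λ k → ∑< k (λ x → f (x % p))) (*-zeroʳ p)
  ∑<-periodic p (suc m) f = begin
    ∑< (p * suc m) (λ x → f (x % p))                         ≡⟨ cong (λ k → ∑< k (λ x → f (x % p))) (*-suc p m) ⟩
    ∑< (p + p * m) (λ x → f (x % p))                         ≡⟨ ∑<-++ p (p * m) (λ x → f (x % p)) ⟩
    ∑< p (λ x → f (x % p)) + ∑< (p * m) (λ x → f ((p + x) % p)) ≡⟨ cong₂ _+_ (∑<-cong p (λ x x<p → cong f (m<n⇒m%n≡m x<p)))
                                                                          (∑<-cong (p * m) (λ x _ → cong f (p+x%p≡x%p x))) ⟩
    ∑< p f + ∑< (p * m) (λ x → f (x % p))                    ≡⟨ cong (∑< p f +_) (∑<-periodic p m f) ⟩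
    ∑< p f + m * ∑< p f                                      ∎
    where
    open ≡-Reasoning
    p+x%p≡x%p : ∀ x → (p + x) % p ≡ x % p
    p+x%p≡x%p x = trans (cong (_% p) (+-comm p x)) ([m+n]%n≡m%n x p)

  ∑<-δ : ∀ n {a} → a < n → ∑< n (λ x → 𝟙 (x ≟ a)) ≡ 1
  ∑<-δ (suc n) {zero} _ = cong suc (trans (∑<-cong n (λ x _ → 𝟙-no (suc x ≟ 0) (λ ()))) (∑<-zero n))
  ∑<-δ (suc n) {suc a} (s≤s a<n) =
    trans (∑<-cong n (λ x _ → 𝟙-cong (suc x ≟ suc a) (x ≟ a) suc-injective (cong suc))) (∑<-δ n a<n)

  ∑<-mono : ∀ n {f g : ℕ → ℕ} → (∀ x → x < n → f x ≤ g x) → ∑< n f ≤ ∑< n g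
  ∑<-mono zero f≤g = z≤n
  ∑<-mono (suc n) f≤g = +-mono-≤ (f≤g 0 z<s) (∑<-mono n (λ x x<n → f≤g (suc x) (s<s x<n)))

  ∑<-mono-≡ : ∀ n {f g : ℕ → ℕ} → (∀ x → x < n → f x ≤ g x) → ∑< n f ≡ ∑< n g → ∀ x → x < n → f x ≡ g x
  ∑<-mono-≡ (suc n) {f} {g} f≤g ∑f≡∑g = pointwise
    where
    f₀≤g₀ = f≤g 0 z<s
    tail≤ : ∀ x → x < n → f (suc x) ≤ g (suc x)
    tail≤ x x<n = f≤g (suc x) (s<s x<n)
    f₀≡g₀ : f 0 ≡ g 0
    f₀≡g₀ = ≤-antisym f₀≤g₀ (+-cancelʳ-≤ _ _ _ (begin
      g 0 + ∑< n (f ∘ suc) ≤⟨ +-monoʳ-≤ (g 0) (∑<-mono n tail≤) ⟩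
      g 0 + ∑< n (g ∘ suc) ≡⟨ sym ∑f≡∑g ⟩
      f 0 + ∑< n (f ∘ suc) ∎))
      where open ≤-Reasoning
    pointwise : ∀ x → x < suc n → f x ≡ g x
    pointwise zero _ = f₀≡g₀
    pointwise (suc x) (s≤s x<n) =
      ∑<-mono-≡ n tail≤ (+-cancelˡ-≡ (f 0) _ _ (trans ∑f≡∑g (cong (_+ _) (sym f₀≡g₀)))) x x<n

  ∑<-bijection : ∀ n (f : ℕ → ℕ) (σ τ : ℕ → ℕ) →
    (∀ x → x < n → σ x < n) → (∀ x → x < n → τ x < n) →
    (∀ x → x < n → σ (τ x) ≡ x) → (∀ x → x < n → τ (σ x) ≡ x) →
    ∑< n (λ x → f (σ x)) ≡ ∑< n f
  ∑<-bijection n f σ τ σ< τ< στ τσ = begin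
    ∑< n (λ x → f (σ x))             ≡⟨ sum-cong-≗ (λ i → cong f (sym (toℕ-fromℕ< (σ< (toℕ i) (toℕ<n i))))) ⟩
    sum (λ i → f (toℕ (σᶠ i)))       ≡⟨ sum-permute (λ i → f (toℕ i)) π ⟨
    ∑< n f                           ∎
    where
    open ≡-Reasoning
    σᶠ τᶠ : Fin n → Fin n
    σᶠ i = fromℕ< (σ< (toℕ i) (toℕ<n i))
    τᶠ i = fromℕ< (τ< (toℕ i) (toℕ<n i))
    π : Permutation n n
    π = permutation σᶠ τᶠ
      (λ i → toℕ-injective (trans (toℕ-fromℕ< _) (trans (cong σ (toℕ-fromℕ< _)) (στ (toℕ i) (toℕ<n i)))))
      (λ i → toℕ-injective (trans (toℕ-fromℕ< _) (trans (cong τ (toℕ-fromℕ< _)) (τσ (toℕ i) (toℕ<n i)))))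

  count : {P : Pred ℕ ℓ} → ℕ → Decidable P → ℕ
  count n P? = ∑< n (λ x → 𝟙 (P? x))

  module _ {P : Pred ℕ ℓ} (P? : Decidable P) where

    count-cong : ∀ n {Q : Pred ℕ ℓ′} (Q? : Decidable Q) →
      (∀ x → x < n → P x → Q x) → (∀ x → x < n → Q x → P x) → count n P? ≡ count n Q?
    count-cong n Q? P⇒Q Q⇒P = ∑<-cong n (λ x x<n → 𝟙-cong (P? x) (Q? x) (P⇒Q x x<n) (Q⇒P x x<n))

    count-none : ∀ n → (∀ x → x < n → ¬ P x) → count n P? ≡ 0
    count-none n ¬P = trans (∑<-cong n (λ x x<n → 𝟙-no (P? x) (¬P x x<n))) (∑<-zero n)

    count-all : ∀ n → (∀ x → x < n → P x) → count n P? ≡ n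
    count-all n allP = trans (∑<-cong n (λ x x<n → 𝟙-yes (P? x) (allP x x<n))) (∑<-one n)

    count-pair : ∀ n {a b} → a < n → b < n → a ≢ b → P a → P b →
      (∀ x → x < n → P x → x ≡ a ⊎ x ≡ b) → count n P? ≡ 2
    count-pair n {a} {b} a<n b<n a≢b Pa Pb P⇒a∨b = begin
      count n P?                                     ≡⟨ ∑<-cong n (λ x x<n → 𝟙-split x (P⇒a∨b x x<n)) ⟩
      ∑< n (λ x → 𝟙 (x ≟ a) + 𝟙 (x ≟ b))             ≡⟨ ∑<-+ n (λ x → 𝟙 (x ≟ a)) (λ x → 𝟙 (x ≟ b)) ⟩
      ∑< n (λ x → 𝟙 (x ≟ a)) + ∑< n (λ x → 𝟙 (x ≟ b)) ≡⟨ cong₂ _+_ (∑<-δ n a<n) (∑<-δ n b<n) ⟩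
      2                                              ∎
      where
      open ≡-Reasoning
      𝟙-split : ∀ x → (P x → x ≡ a ⊎ x ≡ b) → 𝟙 (P? x) ≡ 𝟙 (x ≟ a) + 𝟙 (x ≟ b)
      𝟙-split x P⇒ with x ≟ a | x ≟ b
      ... | yes refl | yes refl = contradiction refl a≢b
      ... | yes refl | no _     = 𝟙-yes (P? x) Pa
      ... | no _     | yes refl = 𝟙-yes (P? x) Pb
      ... | no x≢a   | no x≢b   = 𝟙-no (P? x) (λ Px → [ x≢a , x≢b ]′ (P⇒ Px))

    count-periodic : ∀ p .{{_ : NonZero p}} m →
      (∀ x → P x → P (x % p)) → (∀ x → P (x % p) → P x) → count (p * m) P? ≡ m * count p P?
    count-periodic p m mod⇒ ⇒mod = begin
      count (p * m) P?                       ≡⟨ ∑<-cong (p * m) (λ x _ → 𝟙-cong (P? x) (P? (x % p)) (mod⇒ x) (⇒mod x)) ⟩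
      ∑< (p * m) (λ x → 𝟙 (P? (x % p)))      ≡⟨ ∑<-periodic p m (λ x → 𝟙 (P? x)) ⟩
      m * count p P?                         ∎
      where open ≡-Reasoning

    count-split : ∀ n {Q : Pred ℕ ℓ′} (Q? : Decidable Q) →
      count n P? ≡ count n (λ x → P? x ×-dec Q? x) + count n (λ x → P? x ×-dec ¬? (Q? x))
    count-split n Q? = trans (∑<-cong n (λ x _ → 𝟙-split x)) (∑<-+ n (λ x → 𝟙 (P? x ×-dec Q? x)) (λ x → 𝟙 (P? x ×-dec ¬? (Q? x))))
      where
      𝟙-split : ∀ x → 𝟙 (P? x) ≡ 𝟙 (P? x ×-dec Q? x) + 𝟙 (P? x ×-dec ¬? (Q? x))
      𝟙-split x with P? x | Q? x
      ... | yes _ | yes _ = refl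
      ... | yes _ | no _  = refl
      ... | no _  | _     = refl

    count-fibres : ∀ n (f : ℕ → ℕ) → (∀ x → x < n → f x < n) →
      count n P? ≡ ∑< n (λ z → count n (λ x → P? x ×-dec (f x ≟ z)))
    count-fibres n f f< = trans (∑<-cong n 𝟙-fibre) (∑<-swap n n (λ x z → 𝟙 (P? x ×-dec (f x ≟ z))))
      where
      𝟙-fibre : ∀ x → x < n → 𝟙 (P? x) ≡ ∑< n (λ z → 𝟙 (P? x ×-dec (f x ≟ z)))
      𝟙-fibre x x<n with P? x
      ... | yes Px = sym (trans (∑<-cong n (λ z _ → 𝟙-cong (yes Px ×-dec (f x ≟ z)) (z ≟ f x) (sym ∘ proj₂) (λ z≡ → Px , sym z≡)))
                               (∑<-δ n (f< x x<n)))
      ... | no ¬Px = sym (trans (∑<-cong n (λ z _ → 𝟙-no (no ¬Px ×-dec (f x ≟ z)) (¬Px ∘ proj₁))) (∑<-zero n))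

    count-⊆-≡ : ∀ n {Q : Pred ℕ ℓ′} (Q? : Decidable Q) →
      (∀ x → x < n → P x → Q x) → count n P? ≡ count n Q? → ∀ x → x < n → Q x → P x
    count-⊆-≡ n Q? P⇒Q #P≡#Q x x<n Qx =
      𝟙≡1⇒ (P? x) (trans (∑<-mono-≡ n (λ y y<n → 𝟙-mono (P? y) (Q? y) (P⇒Q y y<n)) #P≡#Q x x<n) (𝟙-yes (Q? x) Qx))

    count-involution : ∀ n (σ : ℕ → ℕ) → (∀ x → x < n → σ x < n) → (∀ x → x < n → σ (σ x) ≡ x) →
      (∀ x → x < n → P x → P (σ x)) →
      count n P? ≡ count n (λ x → P? x ×-dec (σ x ≟ x)) + 2 * count n (λ x → P? x ×-dec (x <? σ x))
    count-involution n σ σ< σσ P⇒Pσ = begin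
      count n P?                         ≡⟨ ∑<-cong n (λ x _ → 𝟙-trichotomy x) ⟩
      ∑< n (λ x → fixed x + up x + down x) ≡⟨ ∑<-+ n (λ x → fixed x + up x) down ⟩
      ∑< n (λ x → fixed x + up x) + ∑< n down ≡⟨ cong₂ _+_ (∑<-+ n fixed up) #down≡#up ⟩
      ∑< n fixed + ∑< n up + ∑< n up     ≡⟨ +-assoc (∑< n fixed) _ _ ⟩
      ∑< n fixed + (∑< n up + ∑< n up)   ≡⟨ cong (λ k → ∑< n fixed + (∑< n up + k)) (sym (+-identityʳ _)) ⟩
      ∑< n fixed + 2 * ∑< n up           ∎
      where
      open ≡-Reasoning
      fixed up down : ℕ → ℕ
      fixed x = 𝟙 (P? x ×-dec (σ x ≟ x))
      up x = 𝟙 (P? x ×-dec (x <? σ x))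
      down x = 𝟙 (P? x ×-dec (σ x <? x))
      𝟙-trichotomy : ∀ x → 𝟙 (P? x) ≡ fixed x + up x + down x
      𝟙-trichotomy x with P? x
      ... | no _  = refl
      ... | yes a = trans (𝟙-trichotomy-< x (σ x)) (sym (cong₂ _+_ (cong₂ _+_ (𝟙-yes-×-dec a (σ x ≟ x)) (𝟙-yes-×-dec a (x <? σ x))) (𝟙-yes-×-dec a (σ x <? x))))
      down≡up∘σ : ∀ x → x < n → down x ≡ up (σ x)
      down≡up∘σ x x<n = 𝟙-cong (P? x ×-dec (σ x <? x)) (P? (σ x) ×-dec (σ x <? σ (σ x)))
        (λ (Px , σx<x) → P⇒Pσ x x<n Px , subst (σ x <_) (sym (σσ x x<n)) σx<x)
        (λ (Pσx , σx<σσx) → subst P (σσ x x<n) (P⇒Pσ (σ x) (σ< x x<n) Pσx) , subst (σ x <_) (σσ x x<n) σx<σσx)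
      #down≡#up : ∑< n down ≡ ∑< n up
      #down≡#up = trans (∑<-cong n down≡up∘σ) (∑<-bijection n up σ σ σ< σ< σσ σσ)

    count-avoiding : ∀ n K (a : ℕ → ℕ) → (∀ j → j < K → a j < n) →
      (∀ j k → j < K → k < K → a j ≡ a k → j ≡ k) → (∀ j → j < K → ¬ P (a j)) →
      (∀ x → x < n → ¬ P x → Σ[ j ∈ ℕ ] j < K × x ≡ a j) →
      count n P? + K ≡ n
    count-avoiding n K a a< a-injective ¬P∘a ¬P⇒∈a = begin
      count n P? + K                                              ≡⟨ cong (count n P? +_) K≡∑δ ⟩
      count n P? + ∑< K (λ j → ∑< n (λ x → 𝟙 (x ≟ a j)))          ≡⟨ cong (count n P? +_) (∑<-swap K n (λ j x → 𝟙 (x ≟ a j))) ⟩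
      count n P? + ∑< n (λ x → ∑< K (λ j → 𝟙 (x ≟ a j)))          ≡⟨ ∑<-+ n (λ x → 𝟙 (P? x)) (λ x → ∑< K (λ j → 𝟙 (x ≟ a j))) ⟨
      ∑< n (λ x → 𝟙 (P? x) + ∑< K (λ j → 𝟙 (x ≟ a j)))            ≡⟨ ∑<-cong n 𝟙-partition ⟩
      ∑< n (λ _ → 1)                                              ≡⟨ ∑<-one n ⟩
      n                                                           ∎
      where
      open ≡-Reasoning
      K≡∑δ : K ≡ ∑< K (λ j → ∑< n (λ x → 𝟙 (x ≟ a j)))
      K≡∑δ = sym (trans (∑<-cong K (λ j j<K → ∑<-δ n (a< j j<K))) (∑<-one K))
      𝟙-partition : ∀ x → x < n → 𝟙 (P? x) + ∑< K (λ j → 𝟙 (x ≟ a j)) ≡ 1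
      𝟙-partition x x<n with P? x
      ... | yes Px = cong suc (trans (∑<-cong K (λ j j<K → 𝟙-no (x ≟ a j) (λ { refl → ¬P∘a j j<K Px }))) (∑<-zero K))
      ... | no ¬Px with ¬P⇒∈a x x<n ¬Px
      ... | j , j<K , refl = trans (∑<-cong K (λ k k<K → 𝟙-cong (a j ≟ a k) (k ≟ j) (sym ∘ a-injective j k j<K k<K) (λ { refl → refl })))
                                   (∑<-δ K j<K)

  length-filter-tabulate : ∀ {n} {P : Pred A ℓ} (P? : Decidable P) (f : Fin n → A) →
    length (filter P? (tabulate f)) ≡ sum (λ i → 𝟙 (P? (f i)))
  length-filter-tabulate {n = zero} P? f = refl
  length-filter-tabulate {n = suc n} P? f with P? (f Fin.zero)
  ... | yes _ = cong suc (length-filter-tabulate P? (f ∘ Fin.suc))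
  ... | no _ = length-filter-tabulate P? (f ∘ Fin.suc)

  length-filter-allFin : ∀ n {P : Pred (Fin n) ℓ} (P? : Decidable P) {Q : Pred ℕ ℓ′} (Q? : Decidable Q) →
    (∀ i → P i → Q (toℕ i)) → (∀ i → Q (toℕ i) → P i) → length (filter P? (allFin n)) ≡ count n Q?
  length-filter-allFin n P? Q? P⇒Q Q⇒P =
    trans (length-filter-tabulate P? id) (sum-cong-≗ (λ i → 𝟙-cong (P? i) (Q? (toℕ i)) (P⇒Q i) (Q⇒P i)))

module Congruence (m : ℕ) where

  open import Data.Nat as ℕ using (ℕ; NonZero)
  import Data.Nat.Properties as ℕ
  import Data.Nat.Divisibility as ℕ
  open import Data.Nat.DivMod using (m<n⇒m%n≡m)
  open import Data.Integer using (ℤ; +_; +0; _+_; _-_; _*_; -_; ∣_∣)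
  open import Data.Integer.Properties using (+-inverseʳ; [+m]-[+n]≡m⊖n; ∣⊖∣-≤; ∣m⊖n∣≡∣n⊖m∣)
  open import Data.Integer.DivMod using (_%ℕ_; _/ℕ_; n%ℕd<d; a≡a%ℕn+[a/ℕn]*n)
  open import Data.Integer.Divisibility.Signed using (_∣_; _∣?_; divides; ∣m∣n⇒∣m+n; ∣m⇒∣m*n; ∣⇒∣ᵤ)
  open import Data.Integer.Tactic.RingSolver using (solve)
  open import Data.List using (_∷_; [])
  open import Data.Sum using (inj₁; inj₂)
  open import Relation.Nullary using (Dec; contradiction)
  open import Relation.Nullary.Decidable using (map′)
  open import Relation.Binary using (Setoid; IsEquivalence)
  open import Relation.Binary.PropositionalEquality
  import Relation.Binary.Reasoning.Setoid as SetoidReasoning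

  private
    [a+b]-a≡b : ∀ a b → (a + b) - a ≡ b
    [a+b]-a≡b a b = solve (a ∷ b ∷ [])

    ordered : ∀ {m x y} → x ℕ.≤ y → y ℕ.< m → m ℕ.∣ y ℕ.∸ x → x ≡ y
    ordered {x = x} {y} x≤y y<m m∣y-x with y ℕ.∸ x in y-x≡
    ... | ℕ.zero = ℕ.≤-antisym x≤y (ℕ.m∸n≡0⇒m≤n y-x≡)
    ... | ℕ.suc d = contradiction (ℕ.∣⇒≤ m∣y-x) (ℕ.<⇒≱ (ℕ.≤-<-trans (subst (ℕ._≤ y) y-x≡ (ℕ.m∸n≤m y x)) y<m))

  infix 4 _≈_ _≈?_
  record _≈_ (a b : ℤ) : Set where
    constructor mk≈
    field m∣a-b : + m ∣ a - b
  open _≈_ public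

  ≈-by-multiple : ∀ {a b} q → a - b ≡ q * + m → a ≈ b
  ≈-by-multiple q eq = mk≈ (divides q eq)

  ≈-lincomb₁ : ∀ {a b x₁ y₁} → x₁ ≈ y₁ → ∀ k₁ → a - b ≡ (x₁ - y₁) * k₁ → a ≈ b
  ≈-lincomb₁ (mk≈ d₁) k₁ eq = mk≈ (subst (+ m ∣_) (sym eq) (∣m⇒∣m*n k₁ d₁))

  ≈-lincomb₂ : ∀ {a b x₁ y₁ x₂ y₂} → x₁ ≈ y₁ → x₂ ≈ y₂ →
    ∀ k₁ k₂ → a - b ≡ (x₁ - y₁) * k₁ + (x₂ - y₂) * k₂ → a ≈ b
  ≈-lincomb₂ (mk≈ d₁) (mk≈ d₂) k₁ k₂ eq = mk≈ (subst (+ m ∣_) (sym eq) (∣m∣n⇒∣m+n (∣m⇒∣m*n k₁ d₁) (∣m⇒∣m*n k₂ d₂)))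

  ≈-lincomb₃ : ∀ {a b x₁ y₁ x₂ y₂ x₃ y₃} → x₁ ≈ y₁ → x₂ ≈ y₂ → x₃ ≈ y₃ →
    ∀ k₁ k₂ k₃ → a - b ≡ (x₁ - y₁) * k₁ + (x₂ - y₂) * k₂ + (x₃ - y₃) * k₃ → a ≈ b
  ≈-lincomb₃ (mk≈ d₁) (mk≈ d₂) (mk≈ d₃) k₁ k₂ k₃ eq =
    mk≈ (subst (+ m ∣_) (sym eq) (∣m∣n⇒∣m+n (∣m∣n⇒∣m+n (∣m⇒∣m*n k₁ d₁) (∣m⇒∣m*n k₂ d₂)) (∣m⇒∣m*n k₃ d₃)))

  ≡⇒≈ : ∀ {a b} → a ≡ b → a ≈ b
  ≡⇒≈ {a} refl = ≈-by-multiple +0 (+-inverseʳ a)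

  ≈-refl : ∀ {a} → a ≈ a
  ≈-refl = ≡⇒≈ refl

  ≈-sym : ∀ {a b} → a ≈ b → b ≈ a
  ≈-sym {a} {b} e = ≈-lincomb₁ e (- + 1) (solve (a ∷ b ∷ []))

  ≈-trans : ∀ {a b c} → a ≈ b → b ≈ c → a ≈ c
  ≈-trans {a} {b} {c} e₁ e₂ = ≈-lincomb₂ e₁ e₂ (+ 1) (+ 1) (solve (a ∷ b ∷ c ∷ []))

  +-cong : ∀ {a b c d} → a ≈ b → c ≈ d → a + c ≈ b + d
  +-cong {a} {b} {c} {d} e₁ e₂ = ≈-lincomb₂ e₁ e₂ (+ 1) (+ 1) (solve (a ∷ b ∷ c ∷ d ∷ []))

  *-cong : ∀ {a b c d} → a ≈ b → c ≈ d → a * c ≈ b * d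
  *-cong {a} {b} {c} {d} e₁ e₂ = ≈-lincomb₂ e₁ e₂ c b (solve (a ∷ b ∷ c ∷ d ∷ []))

  -‿cong : ∀ {a b} → a ≈ b → - a ≈ - b
  -‿cong {a} {b} e = ≈-lincomb₁ e (- + 1) (solve (a ∷ b ∷ []))

  -≈0⇒≈ : ∀ {a b} → a - b ≈ +0 → a ≈ b
  -≈0⇒≈ {a} {b} e = ≈-lincomb₁ e (+ 1) (solve (a ∷ b ∷ []))

  squares⇒product≈0 : ∀ {a b} → a * a ≈ b * b → (a - b) * (a - - b) ≈ +0
  squares⇒product≈0 {a} {b} a²≈b² = ≈-lincomb₁ a²≈b² (+ 1) (solve (a ∷ b ∷ []))

  ≈-isEquivalence : IsEquivalence _≈_
  ≈-isEquivalence = record { refl = ≈-refl ; sym = ≈-sym ; trans = ≈-trans }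

  ≈-setoid : Setoid _ _
  ≈-setoid = record { isEquivalence = ≈-isEquivalence }

  module ≈-Reasoning = SetoidReasoning ≈-setoid

  _≈?_ : ∀ a b → Dec (a ≈ b)
  a ≈? b = map′ mk≈ m∣a-b (+ m ∣? (a - b))

  module _ {{_ : NonZero m}} where

    residue : ℤ → ℕ
    residue z = z %ℕ m

    residue<m : ∀ z → residue z ℕ.< m
    residue<m z = n%ℕd<d z m

    residue≈ : ∀ z → + residue z ≈ z
    residue≈ z = ≈-sym (≈-by-multiple (z /ℕ m) (begin
      z - + residue z                          ≡⟨ cong (_- + residue z) (a≡a%ℕn+[a/ℕn]*n z m) ⟩
      (+ residue z + z /ℕ m * + m) - + residue z ≡⟨ [a+b]-a≡b (+ residue z) (z /ℕ m * + m) ⟩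
      z /ℕ m * + m                             ∎))
      where open ≡-Reasoning

    residue-small : ∀ {x} → x ℕ.< m → residue (+ x) ≡ x
    residue-small = m<n⇒m%n≡m

    ≈⇒≡ : ∀ {x y} → x ℕ.< m → y ℕ.< m → + x ≈ + y → x ≡ y
    ≈⇒≡ {x} {y} x<m y<m (mk≈ m∣x-y) with ℕ.≤-total x y
    ... | inj₁ x≤y = ordered x≤y y<m (subst (m ℕ.∣_) (trans ∣x-y∣ (∣⊖∣-≤ x≤y)) (∣⇒∣ᵤ m∣x-y))
      where ∣x-y∣ = cong ∣_∣ ([+m]-[+n]≡m⊖n x y)
    ... | inj₂ y≤x = sym (ordered y≤x x<m (subst (m ℕ.∣_) (trans ∣x-y∣ (trans (∣m⊖n∣≡∣n⊖m∣ x y) (∣⊖∣-≤ y≤x))) (∣⇒∣ᵤ m∣x-y)))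
      where ∣x-y∣ = cong ∣_∣ ([+m]-[+n]≡m⊖n x y)

    residue-cong : ∀ {a b} → a ≈ b → residue a ≡ residue b
    residue-cong {a} {b} e = ≈⇒≡ (residue<m a) (residue<m b) (≈-trans (residue≈ a) (≈-trans e (≈-sym (residue≈ b))))

    ≈⇒≡residue : ∀ {x z} → x ℕ.< m → + x ≈ z → x ≡ residue z
    ≈⇒≡residue x<m e = trans (sym (residue-small x<m)) (residue-cong e)

    ≡residue⇒≈ : ∀ {x z} → x ≡ residue z → + x ≈ z
    ≡residue⇒≈ {z = z} refl = residue≈ z

    residue-injective : ∀ {a b} → residue a ≡ residue b → a ≈ b
    residue-injective {a} {b} ra≡rb = ≈-trans (≈-sym (residue≈ a)) (≈-trans (≡⇒≈ (cong +_ ra≡rb)) (residue≈ b))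

module PrimePower (p e : ℕ) (p-prime : Prime p) {{_ : NonZero (p ℕ.^ suc e)}} where

  open import Data.Nat as ℕ using (ℕ; suc; NonZero)
  import Data.Nat.Properties as ℕ
  import Data.Nat.Divisibility as ℕ
  open import Data.Nat.Coprimality using (Coprime; coprime-divisor; coprime-Bézout; coprime⇒gcd≡1)
  import Data.Nat.Coprimality as Coprime
  open import Data.Nat.GCD using (gcd-greatest; module Bézout)
  open import Data.Nat.Primality using (Prime; prime⇒irreducible; prime⇒nonZero; prime⇒nonTrivial; euclidsLemma)
  open import Data.Fin using (toℕ)
  open import Data.Integer using (ℤ; +_; +0; _+_; _-_; _*_; -_; ∣_∣)
  open import Data.Integer.Properties using (pos-+; pos-*; abs-*; neg-involutive; *-assoc; *-identityˡ)
  open import Data.Integer.Divisibility.Signed using (_∣_; _∣?_; ∣m⇒∣m*n; ∣n⇒∣m*n; ∣m∣n⇒∣m-n; ∣m∣n⇒∣m+n; ∣m⇒∣-m; ∣-trans; ∣ᵤ⇒∣; ∣⇒∣ᵤ; divides)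
  open import Data.Integer.Tactic.RingSolver using (solve)
  open import Data.List using (_∷_; [])
  open import Data.Product using (Σ-syntax; _,_; proj₁; proj₂)
  open import Data.Sum using (_⊎_; inj₁; inj₂; [_,_]′)
  import Data.Sum as Sum
  open import Function using (_∘_)
  open import Relation.Nullary using (¬_; yes; no; contradiction)
  open import Relation.Nullary.Decidable using (¬?)
  open import Relation.Unary using (Decidable)
  open import Relation.Binary.PropositionalEquality
  open import Defs using (IsUnit)
  open Counting using (𝟙-no; count; count-periodic; count-all)

  N : ℕ
  N = p ℕ.^ suc e

  instance
    p≢0 : NonZero p
    p≢0 = prime⇒nonZero p-prime

  open Congruence N public
  module Modp = Congruence p

  1<p : 1 ℕ.< p
  1<p = ℕ.nonTrivial⇒n>1 p {{prime⇒nonTrivial p-prime}}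

  p∣N : + p ∣ + N
  p∣N = ∣ᵤ⇒∣ (ℕ.m∣m*n (p ℕ.^ e))

  ≈⇒≈ₚ : ∀ {a b} → a ≈ b → a Modp.≈ b
  ≈⇒≈ₚ (mk≈ N∣a-b) = Modp.mk≈ (∣-trans p∣N N∣a-b)

  Unit : ℤ → Set
  Unit z = ¬ (+ p ∣ z)

  unit? : Decidable Unit
  unit? z = ¬? (+ p ∣? z)

  Unit-respₚ : ∀ {a b} → a Modp.≈ b → Unit a → Unit b
  Unit-respₚ {a} {b} (Modp.mk≈ p∣a-b) unit-a p∣b = unit-a (subst (+ p ∣_) a-b+b≡a (∣m∣n⇒∣m+n p∣a-b p∣b))
    where
    a-b+b≡a : (a - b) + b ≡ a
    a-b+b≡a = solve (a ∷ b ∷ [])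

  Unit-resp : ∀ {a b} → a ≈ b → Unit a → Unit b
  Unit-resp = Unit-respₚ ∘ ≈⇒≈ₚ

  p∣*⇒ : ∀ {a b} → + p ∣ a * b → (+ p ∣ a) ⊎ (+ p ∣ b)
  p∣*⇒ {a} {b} p∣ab = Sum.map ∣ᵤ⇒∣ ∣ᵤ⇒∣ (euclidsLemma ∣ a ∣ ∣ b ∣ p-prime (subst (p ℕ.∣_) (abs-* a b) (∣⇒∣ᵤ p∣ab)))

  Unit-* : ∀ {a b} → Unit a → Unit b → Unit (a * b)
  Unit-* unit-a unit-b = [ unit-a , unit-b ]′ ∘ p∣*⇒

  Unit-*ˡ : ∀ {a b} → Unit (a * b) → Unit a
  Unit-*ˡ {b = b} unit-ab = unit-ab ∘ ∣m⇒∣m*n b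

  Unit-*ʳ : ∀ {a b} → Unit (a * b) → Unit b
  Unit-*ʳ {a} unit-ab = unit-ab ∘ ∣n⇒∣m*n a

  Unit-neg : ∀ {a} → Unit a → Unit (- a)
  Unit-neg {a} unit-a p∣-a = unit-a (subst (+ p ∣_) (neg-involutive a) (∣m⇒∣-m p∣-a))

  Unit-small : ∀ {x} → 0 ℕ.< x → x ℕ.< p → Unit (+ x)
  Unit-small {suc x} _ x<p p∣x = ℕ.<⇒≱ x<p (ℕ.∣⇒≤ (∣⇒∣ᵤ p∣x))

  Unit-1 : Unit (+ 1)
  Unit-1 = Unit-small ℕ.z<s 1<p

  Unit-of-inverse : ∀ {a b} → a * b ≈ + 1 → Unit b
  Unit-of-inverse {a} ab≈1 = Unit-*ʳ {a} (Unit-resp (≈-sym ab≈1) Unit-1)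

  coprime-^ : ∀ k {x} → ¬ p ℕ.∣ x → Coprime (p ℕ.^ k) x
  coprime-^ ℕ.zero _ (d∣1 , _) = ℕ.∣1⇒≡1 d∣1
  coprime-^ (suc k) {x} p∤x {d} (d∣p^k⁺ , d∣x) = coprime-^ k p∤x (coprime-divisor d⊥p d∣p^k⁺ , d∣x)
    where
    d⊥p : Coprime d p
    d⊥p (c∣d , c∣p) with prime⇒irreducible p-prime c∣p
    ... | inj₁ c≡1 = c≡1
    ... | inj₂ refl = contradiction (ℕ.∣-trans c∣d d∣x) p∤x

  *-cancelˡ-≈ : ∀ {a b c} → Unit a → a * b ≈ a * c → b ≈ c
  *-cancelˡ-≈ {a} {b} {c} unit-a (mk≈ N∣ab-ac) = mk≈ (∣ᵤ⇒∣ (coprime-divisor N⊥a N∣a[b-c]))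
    where
    N⊥a : Coprime N ∣ a ∣
    N⊥a = coprime-^ (suc e) (unit-a ∘ ∣ᵤ⇒∣)
    N∣a[b-c] : N ℕ.∣ ∣ a ∣ ℕ.* ∣ b - c ∣
    N∣a[b-c] = subst (N ℕ.∣_) (abs-* a (b - c)) (∣⇒∣ᵤ (subst (+ N ∣_) factor N∣ab-ac))
      where
      factor : a * b - a * c ≡ a * (b - c)
      factor = solve (a ∷ b ∷ c ∷ [])

  roots-of-product : ∀ {a b x} → Unit (a - b) → (x - a) * (x - b) ≈ +0 → x ≈ a ⊎ x ≈ b
  roots-of-product {a} {b} {x} unit-a-b prod≈0 with + p ∣? (x - a)
  ... | no unit-x-a = inj₂ (-≈0⇒≈ (*-cancelˡ-≈ unit-x-a (begin
    (x - a) * (x - b) ≈⟨ prod≈0 ⟩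
    +0                ≡⟨ solve (x ∷ a ∷ []) ⟩
    (x - a) * +0      ∎)))
    where open ≈-Reasoning
  ... | yes p∣x-a = inj₁ (-≈0⇒≈ (*-cancelˡ-≈ unit-x-b (begin
    (x - b) * (x - a) ≡⟨ solve (x ∷ a ∷ b ∷ []) ⟩
    (x - a) * (x - b) ≈⟨ prod≈0 ⟩
    +0                ≡⟨ solve (x ∷ b ∷ []) ⟩
    (x - b) * +0      ∎)))
    where
    open ≈-Reasoning
    unit-x-b : Unit (x - b)
    unit-x-b p∣x-b = unit-a-b (subst (+ p ∣_) difference (∣m∣n⇒∣m-n p∣x-b p∣x-a))
      where
      difference : (x - b) - (x - a) ≡ a - b
      difference = solve (x ∷ a ∷ b ∷ [])

  private
    ℕ-identity⇒ℤ : ∀ s t u v → 1 ℕ.+ s ℕ.* t ≡ u ℕ.* v → + 1 + + s * + t ≡ + u * + v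
    ℕ-identity⇒ℤ s t u v eq = begin
      + 1 + + s * + t   ≡⟨ cong (λ k → + 1 + k) (pos-* s t) ⟨
      + 1 + + (s ℕ.* t) ≡⟨ pos-+ 1 (s ℕ.* t) ⟨
      + (1 ℕ.+ s ℕ.* t) ≡⟨ cong +_ eq ⟩
      + (u ℕ.* v)       ≡⟨ pos-* u v ⟩
      + u * + v         ∎
      where open ≡-Reasoning

  inverse-exists : ∀ {x} → ¬ p ℕ.∣ x → Σ[ c ∈ ℤ ] c * + x ≈ + 1
  inverse-exists {x} p∤x with coprime-Bézout (coprime-^ (suc e) p∤x)
  ... | Bézout.+- a b 1+bx≡aN = - + b , ≈-by-multiple (- + a) (negated (+ b) (+ x) (+ a) (+ N) (ℕ-identity⇒ℤ b x a N 1+bx≡aN))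
    where
    negated : ∀ B X A M → + 1 + B * X ≡ A * M → (- B) * X - + 1 ≡ (- A) * M
    negated B X A M eq = begin
      (- B) * X - + 1 ≡⟨ solve (B ∷ X ∷ []) ⟩
      - (+ 1 + B * X) ≡⟨ cong -_ eq ⟩
      - (A * M)       ≡⟨ solve (A ∷ M ∷ []) ⟩
      (- A) * M       ∎
      where open ≡-Reasoning
  ... | Bézout.-+ a b 1+aN≡bx = + b , ≈-by-multiple (+ a) (shifted (+ b) (+ x) (+ a) (+ N) (ℕ-identity⇒ℤ a N b x 1+aN≡bx))
    where
    shifted : ∀ B X A M → + 1 + A * M ≡ B * X → B * X - + 1 ≡ A * M
    shifted B X A M eq = begin
      B * X - + 1         ≡⟨ cong (_- + 1) eq ⟨
      + 1 + A * M - + 1   ≡⟨ solve (A ∷ M ∷ []) ⟩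
      A * M               ∎
      where open ≡-Reasoning

  p∤residue : ∀ {z} → Unit z → ¬ p ℕ.∣ residue z
  p∤residue {z} unit-z = Unit-resp (≈-sym (residue≈ z)) unit-z ∘ ∣ᵤ⇒∣

  ¬∣residue⇒Unit : ∀ {z} → ¬ p ℕ.∣ residue z → Unit z
  ¬∣residue⇒Unit {z} p∤r = Unit-resp (residue≈ z) (p∤r ∘ ∣⇒∣ᵤ)

  -- Junk value inv z = z on non-units, which makes z ↦ residue (inv z) an involution of all of [0, N).
  abstract
    inv : ℤ → ℤ
    inv z with + p ∣? z
    ... | yes _ = z
    ... | no unit-z = proj₁ (inverse-exists (p∤residue unit-z))

    inv-*ˡ : ∀ {z} → Unit z → inv z * z ≈ + 1
    inv-*ˡ {z} unit-z with + p ∣? z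
    ... | yes p∣z = contradiction p∣z unit-z
    ... | no unit-z′ = ≈-trans (*-cong (≈-refl {proj₁ c}) (≈-sym (residue≈ z))) (proj₂ c)
      where
      c : Σ[ c ∈ ℤ ] c * + residue z ≈ + 1
      c = inverse-exists (p∤residue unit-z′)

    inv-nonunit : ∀ {z} → + p ∣ z → inv z ≡ z
    inv-nonunit {z} p∣z with + p ∣? z
    ... | yes _ = refl
    ... | no unit-z = contradiction p∣z unit-z

  inverse-unique : ∀ {a b c} → b * a ≈ + 1 → a * c ≈ + 1 → b ≈ c
  inverse-unique {a} {b} {c} ba≈1 ac≈1 = begin
    b             ≡⟨ solve (b ∷ []) ⟩
    b * + 1       ≈⟨ *-cong (≈-refl {b}) (≈-sym ac≈1) ⟩
    b * (a * c)   ≡⟨ solve (a ∷ b ∷ c ∷ []) ⟩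
    (b * a) * c   ≈⟨ *-cong ba≈1 (≈-refl {c}) ⟩
    + 1 * c       ≡⟨ solve (c ∷ []) ⟩
    c             ∎
    where open ≈-Reasoning

  Unit⇒IsUnit : ∀ j → Unit (+ toℕ j) → IsUnit N j
  Unit⇒IsUnit j unit-j = coprime⇒gcd≡1 (Coprime.sym (coprime-^ (suc e) (unit-j ∘ ∣ᵤ⇒∣)))

  IsUnit⇒Unit : ∀ j → IsUnit N j → Unit (+ toℕ j)
  IsUnit⇒Unit j gcd≡1 p∣j = ℕ.<⇒≢ 1<p (sym (ℕ.∣1⇒≡1 (subst (p ℕ.∣_) gcd≡1 (gcd-greatest (∣⇒∣ᵤ p∣j) (ℕ.m∣m*n (p ℕ.^ e))))))

  ≈ₚ-%p : ∀ x → + x Modp.≈ + (x ℕ.% p)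
  ≈ₚ-%p x = Modp.≈-sym (Modp.residue≈ (+ x))

  count-units : count N (λ x → unit? (+ x)) ≡ p ℕ.^ e ℕ.* (p ℕ.∸ 1)
  count-units = begin
    count (p ℕ.* p ℕ.^ e) U?         ≡⟨ count-periodic U? p (p ℕ.^ e) (λ x → Unit-respₚ (≈ₚ-%p x))
                                                                   (λ x → Unit-respₚ (Modp.≈-sym (≈ₚ-%p x))) ⟩
    p ℕ.^ e ℕ.* count p U?           ≡⟨ cong (λ k → p ℕ.^ e ℕ.* count k U?) (ℕ.suc-pred p) ⟨
    p ℕ.^ e ℕ.* count (suc q) U?     ≡⟨ cong (p ℕ.^ e ℕ.*_) (cong₂ ℕ._+_ (𝟙-no (U? 0) (λ unit-0 → unit-0 (divides +0 refl)))
                                                                          (count-all (λ x → U? (suc x)) q nonzero-units)) ⟩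
    p ℕ.^ e ℕ.* q                    ∎
    where
    open ≡-Reasoning
    q = p ℕ.∸ 1
    U? = λ x → unit? (+ x)
    nonzero-units : ∀ x → x ℕ.< q → Unit (+ suc x)
    nonzero-units x x<q = Unit-small ℕ.z<s (subst (suc x ℕ.<_) (ℕ.suc-pred p) (ℕ.s<s x<q))

  Unit-inv : ∀ {z} → Unit z → Unit (inv z)
  Unit-inv unit-z = Unit-*ˡ (Unit-resp (≈-sym (inv-*ˡ unit-z)) Unit-1)

  residue-*-inverse : ∀ {a b x} → a * b ≈ + 1 → x ℕ.< N → residue (a * + residue (b * + x)) ≡ x
  residue-*-inverse {a} {b} {x} ab≈1 x<N = sym (≈⇒≡residue x<N (≈-sym (begin
    a * + residue (b * + x) ≈⟨ *-cong (≈-refl {a}) (residue≈ (b * + x)) ⟩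
    a * (b * + x)           ≡⟨ *-assoc a b (+ x) ⟨
    (a * b) * + x           ≈⟨ *-cong ab≈1 (≈-refl {+ x}) ⟩
    + 1 * + x               ≡⟨ *-identityˡ (+ x) ⟩
    + x                     ∎)))
    where open ≈-Reasoning

  Unit-diff⇒residue≢ : ∀ {a b} → Unit (a - b) → residue a ≢ residue b
  Unit-diff⇒residue≢ {a} {b} unit-a-b ra≡rb = unit-a-b (Modp.m∣a-b (≈⇒≈ₚ (residue-injective {a} {b} ra≡rb)))

  Unit-diff⇒residueₚ≢ : ∀ {a b} → Unit (a - b) → Modp.residue a ≢ Modp.residue b
  Unit-diff⇒residueₚ≢ {a} {b} unit-a-b ra≡rb = unit-a-b (Modp.m∣a-b (Modp.residue-injective {a} {b} ra≡rb))

module SquareRoots (p e : ℕ) (p-prime : Prime p) (p≡1[4] : p ℕ.% 4 ≡ 1) {{_ : NonZero (p ℕ.^ suc e)}} where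

  open import Data.Nat as ℕ using (ℕ; suc; NonZero; _≟_; _<?_)
  import Data.Nat.Properties as ℕ
  import Data.Nat.Divisibility as ℕ
  open import Data.Nat.DivMod using (m≡m%n+[m/n]*n)
  import Data.Nat.Tactic.RingSolver as NatSolver
  open import Data.Nat.Primality using (Prime)
  open import Data.Integer using (ℤ; +_; _+_; _-_; _*_; -_)
  open import Data.Integer.Properties using (*-identityʳ)
  open import Data.Integer.Divisibility.Signed using (_∣_; _∣?_)
  open import Data.Integer.Tactic.RingSolver using (solve)
  open import Data.List using (_∷_; [])
  open import Data.Product using (∃; _×_; _,_)
  open import Data.Sum using (_⊎_; [_,_]′)
  import Data.Sum as Sum
  open import Relation.Nullary using (¬_; Dec; yes; no; contradiction)
  open import Relation.Nullary.Decidable using (_×-dec_)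
  open import Relation.Unary using (Decidable)
  open import Relation.Binary.PropositionalEquality
  open Counting

  open PrimePower p e p-prime public

  q : ℕ
  q = p ℕ./ 4

  p≡1+q*4 : p ≡ 1 ℕ.+ q ℕ.* 4
  p≡1+q*4 = trans (m≡m%n+[m/n]*n p 4) (cong (ℕ._+ q ℕ.* 4) p≡1[4])

  5≤p : 5 ℕ.≤ p
  5≤p = subst (5 ℕ.≤_) (sym p≡1+q*4) (ℕ.s≤s (ℕ.*-monoˡ-≤ 4 1≤q))
    where
    1≤q : 1 ℕ.≤ q
    1≤q = ℕ.n≢0⇒n>0 (λ q≡0 → ℕ.<⇒≢ 1<p (sym (trans p≡1+q*4 (cong (λ k → 1 ℕ.+ k ℕ.* 4) q≡0))))

  Unit-2 : Unit (+ 2)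
  Unit-2 = Unit-small ℕ.z<s (ℕ.≤-trans (ℕ.s≤s (ℕ.s≤s (ℕ.s≤s ℕ.z≤n))) 5≤p)

  1<N : 1 ℕ.< N
  1<N = ℕ.<-≤-trans 1<p (ℕ.∣⇒≤ (ℕ.m∣m*n (p ℕ.^ e)))

  Unit-a-[-a] : ∀ {a} → Unit a → Unit (a - - a)
  Unit-a-[-a] {a} unit-a p∣a--a = Unit-* Unit-2 unit-a (subst (+ p ∣_) a--a≡2a p∣a--a)
    where
    a--a≡2a : a - - a ≡ + 2 * a
    a--a≡2a = solve (a ∷ [])

  ≉-neg : ∀ {a} → Unit a → ¬ (a ≈ - a)
  ≉-neg unit-a a≈-a = Unit-a-[-a] unit-a (Modp.m∣a-b (≈⇒≈ₚ a≈-a))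

  square : ℕ → ℕ
  square y = residue (+ y * + y)

  IsSquare : ℤ → Set
  IsSquare z = ∃ λ y → y ℕ.< N × + y * + y ≈ z

  square? : Decidable IsSquare
  square? z = ℕ.anyUpTo? (λ y → + y * + y ≈? z) N

  UnitSquare : ℕ → Set
  UnitSquare x = Unit (+ x) × IsSquare (+ x)

  unitSquare? : Decidable UnitSquare
  unitSquare? x = unit? (+ x) ×-dec square? (+ x)

  count-square-roots : ∀ {z} → z ℕ.< N →
    count N (λ y → unit? (+ y) ×-dec (square y ≟ z)) ≡ 2 ℕ.* 𝟙 (unitSquare? z)
  count-square-roots {z} z<N with unitSquare? z
  ... | no ¬□z = count-none (λ y → unit? (+ y) ×-dec (square y ≟ z)) N
    (λ y y<N (unit-y , y²≡z) → ¬□z (Unit-resp (≈-sym (≡residue⇒≈ (sym y²≡z))) (Unit-* unit-y unit-y) ,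
                                    y , y<N , ≈-sym (≡residue⇒≈ (sym y²≡z))))
  ... | yes (unit-z , a , a<N , a²≈z) =
    count-pair (λ y → unit? (+ y) ×-dec (square y ≟ z)) N a<N (residue<m (- + a)) a≢b (unit-a , a²≡z) (unit-b , b²≡z) roots
    where
    b = residue (- + a)
    unit-a : Unit (+ a)
    unit-a = Unit-*ˡ (Unit-resp (≈-sym a²≈z) unit-z)
    unit-b : Unit (+ b)
    unit-b = Unit-resp (≈-sym (residue≈ (- + a))) (Unit-neg unit-a)
    a≢b : a ≢ b
    a≢b a≡b = ≉-neg unit-a (≡residue⇒≈ a≡b)
    a²≡z : square a ≡ z
    a²≡z = sym (≈⇒≡residue z<N (≈-sym a²≈z))
    b²≡z : square b ≡ z
    b²≡z = sym (≈⇒≡residue z<N (begin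
      + z               ≈⟨ a²≈z ⟨
      + a * + a         ≡⟨ neg-square (+ a) ⟩
      (- + a) * (- + a) ≈⟨ *-cong (residue≈ (- + a)) (residue≈ (- + a)) ⟨
      + b * + b         ∎))
      where
      open ≈-Reasoning
      neg-square : ∀ w → w * w ≡ (- w) * (- w)
      neg-square w = solve (w ∷ [])
    roots : ∀ y → y ℕ.< N → Unit (+ y) × square y ≡ z → y ≡ a ⊎ y ≡ b
    roots y y<N (_ , y²≡z) = Sum.map (≈⇒≡ y<N a<N) (≈⇒≡residue y<N)
      (roots-of-product {+ a} { - + a} {+ y} (Unit-a-[-a] unit-a)
        (squares⇒product≈0 {+ y} {+ a} (≈-trans (≈-sym (≡residue⇒≈ (sym y²≡z))) (≈-sym a²≈z))))

  count-units≡2*count-unit-squares : count N (λ x → unit? (+ x)) ≡ 2 ℕ.* count N unitSquare?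
  count-units≡2*count-unit-squares = begin
    count N (λ x → unit? (+ x))
      ≡⟨ count-fibres (λ x → unit? (+ x)) N square (λ y _ → residue<m (+ y * + y)) ⟩
    ∑< N (λ z → count N (λ y → unit? (+ y) ×-dec (square y ≟ z)))
      ≡⟨ ∑<-cong N (λ z → count-square-roots) ⟩
    ∑< N (λ z → 2 ℕ.* 𝟙 (unitSquare? z))
      ≡⟨ ∑<-*ˡ N 2 (λ z → 𝟙 (unitSquare? z)) ⟩
    2 ℕ.* count N unitSquare?
      ∎
    where open ≡-Reasoning

  count-unit-squares : count N unitSquare? ≡ 2 ℕ.* (p ℕ.^ e ℕ.* q)
  count-unit-squares = ℕ.*-cancelˡ-≡ _ _ 2 (begin
    2 ℕ.* count N unitSquare?       ≡⟨ count-units≡2*count-unit-squares ⟨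
    count N (λ x → unit? (+ x))     ≡⟨ count-units ⟩
    p ℕ.^ e ℕ.* (p ℕ.∸ 1)           ≡⟨ cong (λ k → p ℕ.^ e ℕ.* (k ℕ.∸ 1)) p≡1+q*4 ⟩
    p ℕ.^ e ℕ.* (q ℕ.* 4)           ≡⟨ arithmetic (p ℕ.^ e) q ⟩
    2 ℕ.* (2 ℕ.* (p ℕ.^ e ℕ.* q))   ∎)
    where
    open ≡-Reasoning
    arithmetic : ∀ a q → a ℕ.* (q ℕ.* 4) ≡ 2 ℕ.* (2 ℕ.* (a ℕ.* q))
    arithmetic = NatSolver.solve-∀

  reciprocal : ℕ → ℕ
  reciprocal x = residue (inv (+ x))

  reciprocal<N : ∀ x → reciprocal x ℕ.< N
  reciprocal<N x = residue<m (inv (+ x))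

  reciprocal-*ˡ : ∀ {x} → Unit (+ x) → + reciprocal x * + x ≈ + 1
  reciprocal-*ˡ {x} unit-x = ≈-trans (*-cong (residue≈ (inv (+ x))) (≈-refl {+ x})) (inv-*ˡ unit-x)

  Unit-reciprocal : ∀ {x} → Unit (+ x) → Unit (+ reciprocal x)
  Unit-reciprocal {x} unit-x = Unit-resp (≈-sym (residue≈ (inv (+ x)))) (Unit-inv unit-x)

  reciprocal-involutive : ∀ x → x ℕ.< N → reciprocal (reciprocal x) ≡ x
  reciprocal-involutive x x<N = by-cases (+ p ∣? + x)
    where
    by-cases : Dec (+ p ∣ + x) → reciprocal (reciprocal x) ≡ x
    by-cases (yes p∣x) = trans (cong reciprocal rx≡x) rx≡x
      where
      rx≡x : reciprocal x ≡ x
      rx≡x = trans (cong residue (inv-nonunit p∣x)) (residue-small x<N)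
    by-cases (no unit-x) =
      ≈⇒≡ (reciprocal<N (reciprocal x)) x<N (inverse-unique (reciprocal-*ˡ (Unit-reciprocal unit-x)) (reciprocal-*ˡ unit-x))

  UnitSquare-reciprocal : ∀ x → x ℕ.< N → UnitSquare x → UnitSquare (reciprocal x)
  UnitSquare-reciprocal x _ (unit-x , y , _ , y²≈x) = Unit-reciprocal unit-x , residue w , residue<m w , w²≈r
    where
    r = + reciprocal x
    w = r * + y
    regroup : ∀ c d → (c * d) * (c * d) ≡ c * (c * (d * d))
    regroup c d = solve (c ∷ d ∷ [])
    w²≈r : + residue w * + residue w ≈ r
    w²≈r = begin
      + residue w * + residue w   ≈⟨ *-cong (residue≈ w) (residue≈ w) ⟩
      w * w                       ≡⟨ regroup r (+ y) ⟩
      r * (r * (+ y * + y))       ≈⟨ *-cong (≈-refl {r}) (*-cong (≈-refl {r}) y²≈x) ⟩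
      r * (r * + x)               ≈⟨ *-cong (≈-refl {r}) (reciprocal-*ˡ unit-x) ⟩
      r * + 1                     ≡⟨ *-identityʳ r ⟩
      r                           ∎
      where open ≈-Reasoning

  count-fixed-unit-squares : ¬ IsSquare (- + 1) → count N (λ x → unitSquare? x ×-dec (reciprocal x ≟ x)) ≡ 1
  count-fixed-unit-squares ¬□-1 =
    trans (count-cong (λ x → unitSquare? x ×-dec (reciprocal x ≟ x)) N (_≟ 1) fixed⇒1 1⇒fixed) (∑<-δ N 1<N)
    where
    fixed⇒1 : ∀ x → x ℕ.< N → UnitSquare x × reciprocal x ≡ x → x ≡ 1
    fixed⇒1 x x<N ((unit-x , y , y<N , y²≈x) , rx≡x) =
      [ ≈⇒≡ x<N 1<N , (λ x≈-1 → contradiction (y , y<N , ≈-trans y²≈x x≈-1) ¬□-1) ]′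
        (roots-of-product {+ 1} { - + 1} {+ x} Unit-2
          (squares⇒product≈0 {+ x} {+ 1} (subst (λ k → + k * + x ≈ + 1) rx≡x (reciprocal-*ˡ unit-x))))
    1⇒fixed : ∀ x → x ℕ.< N → x ≡ 1 → UnitSquare x × reciprocal x ≡ x
    1⇒fixed x _ refl = (Unit-1 , 1 , 1<N , ≈-refl) ,
                       ≈⇒≡ (reciprocal<N 1) 1<N (≈-trans (≡⇒≈ (sym (*-identityʳ (+ reciprocal 1)))) (reciprocal-*ˡ Unit-1))

  √-1 : ∃ λ i → i * i ≈ - + 1
  √-1 with square? (- + 1)
  ... | yes (i , _ , i²≈-1) = + i , i²≈-1
  ... | no ¬□-1 = contradiction #squares-odd (ℕ.even≢odd (p ℕ.^ e ℕ.* q) #pairs)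
    where
    #pairs = count N (λ x → unitSquare? x ×-dec (x <? reciprocal x))
    #squares-odd : 2 ℕ.* (p ℕ.^ e ℕ.* q) ≡ 1 ℕ.+ 2 ℕ.* #pairs
    #squares-odd = begin
      2 ℕ.* (p ℕ.^ e ℕ.* q)
        ≡⟨ count-unit-squares ⟨
      count N unitSquare?
        ≡⟨ count-involution unitSquare? N reciprocal (λ x _ → reciprocal<N x) reciprocal-involutive UnitSquare-reciprocal ⟩
      count N (λ x → unitSquare? x ×-dec (reciprocal x ≟ x)) ℕ.+ 2 ℕ.* #pairs
        ≡⟨ cong (ℕ._+ 2 ℕ.* #pairs) (count-fixed-unit-squares ¬□-1) ⟩
      1 ℕ.+ 2 ℕ.* #pairs
        ∎
      where open ≡-Reasoning

module QuadraticCharacter (p e : ℕ) (p-prime : Prime p) (p≡1[4] : p ℕ.% 4 ≡ 1) {{_ : NonZero (p ℕ.^ suc e)}}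
    (χ : Fin (p ℕ.^ suc e) → ℤ) (χ-character : IsDirichletCharacter (p ℕ.^ suc e) χ)
    (χ-order2 : HasOrder2 (p ℕ.^ suc e) χ) where

  open import Data.Nat as ℕ using (ℕ; suc; NonZero)
  import Data.Nat.Properties as ℕ
  open import Data.Nat.Primality using (Prime)
  open import Data.Fin using (Fin; toℕ; fromℕ<)
  open import Data.Fin.Properties using (toℕ-fromℕ<; toℕ-injective; toℕ<n)
  open import Data.Integer using (ℤ; +_; -[1+_]; _+_; _-_; _*_; -_) renaming (_≟_ to _≟ℤ_)
  open import Data.Integer.Properties using (pos-*; *-comm)
  open import Data.Product using (∃; _×_; _,_; proj₁; proj₂)
  open import Data.Sum using (_⊎_; inj₁; inj₂)
  open import Function using (_∘_)
  open import Relation.Nullary using (¬_; contradiction)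
  open import Relation.Nullary.Decidable using (_×-dec_; ¬?)
  open import Relation.Unary using (Decidable)
  open import Relation.Binary.PropositionalEquality
  open import Defs using (IsDirichletCharacter; HasOrder2; mulZ)
  open Counting

  open SquareRoots p e p-prime p≡1[4] public
  open IsDirichletCharacter χ-character
  open HasOrder2 χ-order2

  toFin : ℤ → Fin N
  toFin z = fromℕ< (residue<m z)

  toFin-cong : ∀ {a b} → a ≈ b → toFin a ≡ toFin b
  toFin-cong a≈b = toℕ-injective (trans (toℕ-fromℕ< _) (trans (residue-cong a≈b) (sym (toℕ-fromℕ< _))))

  toFin-toℕ : ∀ j → toFin (+ toℕ j) ≡ j
  toFin-toℕ j = toℕ-injective (trans (toℕ-fromℕ< _) (residue-small (toℕ<n j)))

  χℤ : ℤ → ℤ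
  χℤ z = χ (toFin z)

  χℤ-cong : ∀ {a b} → a ≈ b → χℤ a ≡ χℤ b
  χℤ-cong = cong χ ∘ toFin-cong

  χℤ-* : ∀ a b → χℤ (a * b) ≡ χℤ a * χℤ b
  χℤ-* a b = trans (cong χ toFin-*) (χ-mul (toFin a) (toFin b))
    where
    ab≈rarb : a * b ≈ + (residue a ℕ.* residue b)
    ab≈rarb = ≈-sym (≈-trans (≡⇒≈ (pos-* (residue a) (residue b))) (*-cong (residue≈ a) (residue≈ b)))
    toFin-* : toFin (a * b) ≡ mulZ N (toFin a) (toFin b)
    toFin-* = toℕ-injective (begin
      toℕ (toFin (a * b))                               ≡⟨ toℕ-fromℕ< _ ⟩
      residue (a * b)                                   ≡⟨ residue-cong ab≈rarb ⟩
      residue (+ (residue a ℕ.* residue b))             ≡⟨ cong₂ (λ x y → (x ℕ.* y) ℕ.% N) (toℕ-fromℕ< (residue<m a)) (toℕ-fromℕ< (residue<m b)) ⟨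
      (toℕ (toFin a) ℕ.* toℕ (toFin b)) ℕ.% N           ≡⟨ toℕ-fromℕ< _ ⟨
      toℕ (mulZ N (toFin a) (toFin b))                  ∎)
      where open ≡-Reasoning

  private
    square≡1⇒±1 : ∀ w → w * w ≡ + 1 → w ≡ + 1 ⊎ w ≡ - + 1
    square≡1⇒±1 (+ 1) _ = inj₁ refl
    square≡1⇒±1 -[1+ 0 ] _ = inj₂ refl
    square≡1⇒±1 (+ 0) ()
    square≡1⇒±1 (+ suc (suc _)) ()
    square≡1⇒±1 -[1+ suc _ ] ()

  χℤ²≡1 : ∀ {z} → Unit z → χℤ z * χℤ z ≡ + 1
  χℤ²≡1 {z} unit-z = sq-principal (toFin z) (Unit⇒IsUnit (toFin z) (subst (Unit ∘ +_) (sym (toℕ-fromℕ< _)) unit-r))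
    where
    unit-r : Unit (+ residue z)
    unit-r = Unit-resp (≈-sym (residue≈ z)) unit-z

  χℤ-±1 : ∀ {z} → Unit z → χℤ z ≡ + 1 ⊎ χℤ z ≡ - + 1
  χℤ-±1 unit-z = square≡1⇒±1 _ (χℤ²≡1 unit-z)

  χℤ-square : ∀ {y} → Unit y → χℤ (y * y) ≡ + 1
  χℤ-square {y} unit-y = trans (χℤ-* y y) (χℤ²≡1 unit-y)

  nonresidue : ∃ λ g → Unit g × χℤ g ≡ - + 1
  nonresidue = + toℕ a , unit-a , χ-1 (χℤ-±1 unit-a)
    where
    a = proj₁ not-principal
    unit-a = IsUnit⇒Unit a (proj₁ (proj₂ not-principal))
    χ-1 : χℤ (+ toℕ a) ≡ + 1 ⊎ χℤ (+ toℕ a) ≡ - + 1 → χℤ (+ toℕ a) ≡ - + 1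
    χ-1 (inj₁ χa≡1) = contradiction (trans (sym (cong χ (toFin-toℕ a))) χa≡1) (proj₂ (proj₂ not-principal))
    χ-1 (inj₂ χa≡-1) = χa≡-1

  QR : ℕ → Set
  QR x = Unit (+ x) × χℤ (+ x) ≡ + 1

  qr? : Decidable QR
  qr? x = unit? (+ x) ×-dec (χℤ (+ x) ≟ℤ + 1)

  count-units≡2*count-QR : count N (λ x → unit? (+ x)) ≡ 2 ℕ.* count N qr?
  count-units≡2*count-QR = begin
    count N (λ x → unit? (+ x))                        ≡⟨ count-split (λ x → unit? (+ x)) N (λ x → χℤ (+ x) ≟ℤ + 1) ⟩
    count N qr? ℕ.+ count N non-QR?                    ≡⟨ cong (count N qr? ℕ.+_) #non-QR≡#QR ⟩
    count N qr? ℕ.+ count N qr?                        ≡⟨ cong (count N qr? ℕ.+_) (ℕ.+-identityʳ _) ⟨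
    2 ℕ.* count N qr?                                  ∎
    where
    open ≡-Reasoning
    non-QR? = λ x → unit? (+ x) ×-dec ¬? (χℤ (+ x) ≟ℤ + 1)
    g = proj₁ nonresidue
    unit-g = proj₁ (proj₂ nonresidue)
    χg≡-1 = proj₂ (proj₂ nonresidue)
    σ τ : ℕ → ℕ
    σ x = residue (g * + x)
    τ x = residue (inv g * + x)
    σ∘τ : ∀ x → x ℕ.< N → σ (τ x) ≡ x
    σ∘τ x = residue-*-inverse {g} {inv g} {x} (≈-trans (≡⇒≈ (*-comm g (inv g))) (inv-*ˡ unit-g))
    τ∘σ : ∀ x → x ℕ.< N → τ (σ x) ≡ x
    τ∘σ x = residue-*-inverse {inv g} {g} {x} (inv-*ˡ unit-g)
    χℤσ : ∀ x → χℤ (+ σ x) ≡ - + 1 * χℤ (+ x)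
    χℤσ x = trans (χℤ-cong (residue≈ (g * + x))) (trans (χℤ-* g (+ x)) (cong (_* χℤ (+ x)) χg≡-1))
    non-QR⇒QR∘σ : ∀ x → x ℕ.< N → Unit (+ x) × ¬ χℤ (+ x) ≡ + 1 → QR (σ x)
    non-QR⇒QR∘σ x _ (unit-x , χx≢1) =
      Unit-resp (≈-sym (residue≈ (g * + x))) (Unit-* unit-g unit-x) , trans (χℤσ x) (cong (- + 1 *_) (χx≡-1 (χℤ-±1 unit-x)))
      where
      χx≡-1 : χℤ (+ x) ≡ + 1 ⊎ χℤ (+ x) ≡ - + 1 → χℤ (+ x) ≡ - + 1
      χx≡-1 (inj₁ χx≡1) = contradiction χx≡1 χx≢1
      χx≡-1 (inj₂ χx≡-1) = χx≡-1
    QR∘σ⇒non-QR : ∀ x → x ℕ.< N → QR (σ x) → Unit (+ x) × ¬ χℤ (+ x) ≡ + 1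
    QR∘σ⇒non-QR x _ (unit-σx , χσx≡1) =
      Unit-*ʳ {g} (Unit-resp (residue≈ (g * + x)) unit-σx) ,
      λ χx≡1 → -1≢1 (trans (trans (cong (- + 1 *_) (sym χx≡1)) (sym (χℤσ x))) χσx≡1)
      where
      -1≢1 : - + 1 ≢ + 1
      -1≢1 ()
    #non-QR≡#QR : count N non-QR? ≡ count N qr?
    #non-QR≡#QR = trans (count-cong non-QR? N (qr? ∘ σ) non-QR⇒QR∘σ QR∘σ⇒non-QR)
                        (∑<-bijection N (λ x → 𝟙 (qr? x)) σ τ (λ x _ → residue<m (g * + x)) (λ x _ → residue<m (inv g * + x)) σ∘τ τ∘σ)

  QR⇒square : ∀ {z} → Unit z → χℤ z ≡ + 1 → ∃ λ y → y * y ≈ z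
  QR⇒square {z} unit-z χz≡1 = + y , ≈-trans y²≈r (residue≈ z)
    where
    unit-square⇒QR : ∀ x → x ℕ.< N → UnitSquare x → QR x
    unit-square⇒QR x _ (unit-x , y , _ , y²≈x) =
      unit-x , trans (sym (χℤ-cong y²≈x)) (χℤ-square {+ y} (Unit-*ˡ (Unit-resp (≈-sym y²≈x) unit-x)))
    #squares≡#QR : count N unitSquare? ≡ count N qr?
    #squares≡#QR = ℕ.*-cancelˡ-≡ _ _ 2 (trans (sym count-units≡2*count-unit-squares) count-units≡2*count-QR)
    QR-r : QR (residue z)
    QR-r = Unit-resp (≈-sym (residue≈ z)) unit-z , trans (χℤ-cong (residue≈ z)) χz≡1
    square-r : UnitSquare (residue z)
    square-r = count-⊆-≡ unitSquare? N qr? unit-square⇒QR #squares≡#QR (residue z) (residue<m z) QR-r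
    y = proj₁ (proj₂ square-r)
    y²≈r : + y * + y ≈ + residue z
    y²≈r = proj₂ (proj₂ (proj₂ square-r))

module Parametrisation (p e : ℕ) (p-prime : Prime p) (p≡1[4] : p ℕ.% 4 ≡ 1) {{_ : NonZero (p ℕ.^ suc e)}}
    (χ : Fin (p ℕ.^ suc e) → ℤ) (χ-character : IsDirichletCharacter (p ℕ.^ suc e) χ)
    (χ-order2 : HasOrder2 (p ℕ.^ suc e) χ) where

  open import Data.Nat as ℕ using (ℕ; suc; NonZero; _≟_)
  import Data.Nat.Properties as ℕ
  import Data.Nat.Divisibility as ℕ
  open import Data.Nat.Primality using (Prime)
  open import Data.Fin using (Fin; toℕ)
  open import Data.Fin.Properties using (toℕ-fromℕ<; toℕ-injective; toℕ<n)
  open import Data.Integer using (ℤ; +_; +0; _+_; _-_; _*_; -_; _⊖_) renaming (_≟_ to _≟ℤ_)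
  open import Data.Integer.Properties using (*-comm; +-comm; *-identityʳ; *-distribˡ-+; +-identityˡ; +-identityʳ; neg-distrib-+; neg-involutive; ⊖-≥; [+m]-[+n]≡m⊖n; pos-+; pos-*)
  open import Data.Integer.Divisibility.Signed using (_∣_; _∣?_; divides; ∣m∣n⇒∣m-n; ∣ᵤ⇒∣; ∣⇒∣ᵤ)
  open import Data.Integer.Tactic.RingSolver using (solve)
  open import Data.List using (_∷_; [])
  open import Data.Product using (∃; _×_; _,_; proj₁; proj₂)
  open import Data.Sum using (_⊎_; [_,_]′)
  import Data.Sum as Sum
  open import Relation.Nullary using (¬_; Dec; yes; no; contradiction)
  open import Relation.Nullary.Decidable using (_×-dec_)
  open import Relation.Unary using (Decidable)
  open import Relation.Binary using (tri<; tri≈; tri>)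
  open import Relation.Binary.PropositionalEquality
  open import Function using (_∘_)
  open import Defs using (IsDirichletCharacter; HasOrder2; oneMinusSq; countSet)
  open Counting

  open QuadraticCharacter p e p-prime p≡1[4] χ χ-character χ-order2 public

  -- Abstract, so that the type checker never unfolds the counting argument behind √-1.
  abstract
    i : ℤ
    i = proj₁ √-1

    i²≈-1 : i * i ≈ - + 1
    i²≈-1 = proj₂ √-1

  Unit-i : Unit i
  Unit-i = Unit-*ˡ (Unit-resp (≈-sym i²≈-1) (Unit-neg Unit-1))

  p∣i²+1 : + p ∣ i * i + + 1
  p∣i²+1 = Modp.m∣a-b (≈⇒≈ₚ i²≈-1)

  p∣0 : + p ∣ +0
  p∣0 = divides +0 refl

  ½ : ℤ
  ½ = inv (+ 2)

  ½*2≈1 : ½ * + 2 ≈ + 1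
  ½*2≈1 = inv-*ˡ Unit-2

  Unit-½ : Unit ½
  Unit-½ = Unit-inv Unit-2

  Vℤ : ℤ → Set
  Vℤ w = Unit w × Unit (w * w + + 1) × Unit (w * w - + 1)

  V : ℕ → Set
  V u = Vℤ (+ u)

  V? : Decidable V
  V? u = unit? (+ u) ×-dec unit? (+ u * + u + + 1) ×-dec unit? (+ u * + u - + 1)

  A : ℕ → Set
  A x = Unit (+ x) × Unit (+ 1 - + x * + x) × χℤ (+ 1 - + x * + x) ≡ + 1

  A? : Decidable A
  A? x = unit? (+ x) ×-dec unit? (+ 1 - + x * + x) ×-dec (χℤ (+ 1 - + x * + x) ≟ℤ + 1)

  joukowski : ℕ → ℕ
  joukowski u = residue ((+ u + inv (+ u)) * ½)

  2*joukowski : ∀ {u x} → joukowski u ≡ x → + 2 * + x ≈ + u + inv (+ u)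
  2*joukowski {u} {x} refl = begin
    + 2 * + x               ≈⟨ *-cong (≈-refl {+ 2}) (residue≈ (s * ½)) ⟩
    + 2 * (s * ½)           ≡⟨ regroup s ½ ⟩
    s * (½ * + 2)           ≈⟨ *-cong (≈-refl {s}) ½*2≈1 ⟩
    s * + 1                 ≡⟨ *-identityʳ s ⟩
    s                       ∎
    where
    open ≈-Reasoning
    s = + u + inv (+ u)
    regroup : ∀ a b → + 2 * (a * b) ≡ a * (b * + 2)
    regroup a b = solve (a ∷ b ∷ [])

  V⇒A : ∀ {u x} → V u → joukowski u ≡ x → A x
  V⇒A {u} (unit-u , unit-u²+1 , unit-u²-1) refl =
    Unit-resp (≈-sym x≈s½) (Unit-* unit-s Unit-½) ,
    Unit-resp (≈-sym 1-x²≈y²) (Unit-* unit-y unit-y) ,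
    trans (χℤ-cong 1-x²≈y²) (χℤ-square unit-y)
    where
    c = inv (+ u)
    s = + u + c
    d = + u - c
    y = i * d * ½
    cu≈1 : c * + u ≈ + 1
    cu≈1 = inv-*ˡ unit-u
    x≈s½ : + joukowski u ≈ s * ½
    x≈s½ = residue≈ (s * ½)
    unit-s : Unit s
    unit-s = Unit-*ʳ {+ u} (Unit-resp (≈-sym (≈-lincomb₁ cu≈1 (+ 1) (expand-s (+ u) c))) unit-u²+1)
      where
      expand-s : ∀ U C → U * (U + C) - (U * U + + 1) ≡ (C * U - + 1) * + 1
      expand-s U C = solve (U ∷ C ∷ [])
    unit-d : Unit d
    unit-d = Unit-*ʳ {+ u} (Unit-resp (≈-sym (≈-lincomb₁ cu≈1 (- + 1) (expand-d (+ u) c))) unit-u²-1)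
      where
      expand-d : ∀ U C → U * (U - C) - (U * U - + 1) ≡ (C * U - + 1) * - + 1
      expand-d U C = solve (U ∷ C ∷ [])
    unit-y : Unit y
    unit-y = Unit-* (Unit-* Unit-i unit-d) Unit-½
    key : ∀ U C H I → (+ 1 - (U + C) * H * ((U + C) * H)) - I * (U - C) * H * (I * (U - C) * H)
      ≡ (H * + 2 - + 1) * - (+ 1 + + 2 * H) + (C * U - + 1) * - (+ 4 * H * H) + (I * I - - + 1) * - ((U - C) * (U - C) * H * H)
    key U C H I = solve (U ∷ C ∷ H ∷ I ∷ [])
    1-x²≈y² : + 1 - + joukowski u * + joukowski u ≈ y * y
    1-x²≈y² = begin
      + 1 - + joukowski u * + joukowski u ≈⟨ +-cong (≈-refl {+ 1}) (-‿cong (*-cong x≈s½ x≈s½)) ⟩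
      + 1 - s * ½ * (s * ½)               ≈⟨ ≈-lincomb₃ ½*2≈1 cu≈1 i²≈-1 _ _ _ (key (+ u) c ½ i) ⟩
      y * y                               ∎
      where open ≈-Reasoning

  module Preimages {x} (x<N : x ℕ.< N) (Ax : A x) where

    unit-x = proj₁ Ax
    unit-1-x² = proj₁ (proj₂ Ax)

    y : ℤ
    y = proj₁ (QR⇒square unit-1-x² (proj₂ (proj₂ Ax)))

    y²≈1-x² : y * y ≈ + 1 - + x * + x
    y²≈1-x² = proj₂ (QR⇒square unit-1-x² (proj₂ (proj₂ Ax)))

    Unit-2iy : Unit (+ 2 * (i * y))
    Unit-2iy = Unit-* Unit-2 (Unit-* Unit-i (Unit-*ˡ (Unit-resp (≈-sym y²≈1-x²) unit-1-x²)))

    u₀ u₁ : ℤ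
    u₀ = + x + i * y
    u₁ = + x - i * y

    u₀u₁≈1 : u₀ * u₁ ≈ + 1
    u₀u₁≈1 = ≈-lincomb₂ y²≈1-x² i²≈-1 (+ 1) (- (y * y)) (conjugates (+ x) i y)
      where
      conjugates : ∀ X I Y → (X + I * Y) * (X - I * Y) - + 1 ≡ (Y * Y - (+ 1 - X * X)) * + 1 + (I * I - - + 1) * - (Y * Y)
      conjugates X I Y = solve (X ∷ I ∷ Y ∷ [])

    u₁u₀≈1 : u₁ * u₀ ≈ + 1
    u₁u₀≈1 = ≈-trans (≡⇒≈ (*-comm u₁ u₀)) u₀u₁≈1

    Unit-u₀-u₁ : Unit (u₀ - u₁)
    Unit-u₀-u₁ = subst Unit (difference (+ x) i y) Unit-2iy
      where
      difference : ∀ X I Y → + 2 * (I * Y) ≡ (X + I * Y) - (X - I * Y)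
      difference X I Y = solve (X ∷ I ∷ Y ∷ [])

    Unit-u₁-u₀ : Unit (u₁ - u₀)
    Unit-u₁-u₀ = subst Unit (difference (+ x) i y) (Unit-neg Unit-2iy)
      where
      difference : ∀ X I Y → - (+ 2 * (I * Y)) ≡ (X - I * Y) - (X + I * Y)
      difference X I Y = solve (X ∷ I ∷ Y ∷ [])

    preimage : ∀ {u v} → u * v ≈ + 1 → Unit (u - v) → u + v ≡ + 2 * + x → V (residue u) × joukowski (residue u) ≡ x
    preimage {u} {v} uv≈1 unit-u-v u+v≡2x = (unit-r , unit-r²+1 , unit-r²-1) , sym (≈⇒≡residue x<N (≈-sym [r+r⁻¹]½≈x))
      where
      r = residue u
      r≈u : + r ≈ u
      r≈u = residue≈ u
      unit-u : Unit u
      unit-u = Unit-of-inverse {v} (≈-trans (≡⇒≈ (*-comm v u)) uv≈1)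
      unit-r : Unit (+ r)
      unit-r = Unit-resp (≈-sym r≈u) unit-u
      unit-r²+1 : Unit (+ r * + r + + 1)
      unit-r²+1 = Unit-resp (begin
        u * (u + v)           ≡⟨ *-distribˡ-+ u u v ⟩
        u * u + u * v         ≈⟨ +-cong (*-cong (≈-sym r≈u) (≈-sym r≈u)) uv≈1 ⟩
        + r * + r + + 1       ∎) (Unit-* unit-u (subst Unit (sym u+v≡2x) (Unit-* Unit-2 unit-x)))
        where open ≈-Reasoning
      unit-r²-1 : Unit (+ r * + r - + 1)
      unit-r²-1 = Unit-resp (begin
        u * (u - v)           ≡⟨ expand u v ⟩
        u * u - u * v         ≈⟨ +-cong (*-cong (≈-sym r≈u) (≈-sym r≈u)) (-‿cong uv≈1) ⟩
        + r * + r - + 1       ∎) (Unit-* unit-u unit-u-v)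
        where
        open ≈-Reasoning
        expand : ∀ a b → a * (a - b) ≡ a * a - a * b
        expand a b = solve (a ∷ b ∷ [])
      r⁻¹≈v : inv (+ r) ≈ v
      r⁻¹≈v = inverse-unique (inv-*ˡ unit-r) (≈-trans (*-cong r≈u (≈-refl {v})) uv≈1)
      [r+r⁻¹]½≈x : (+ r + inv (+ r)) * ½ ≈ + x
      [r+r⁻¹]½≈x = begin
        (+ r + inv (+ r)) * ½ ≈⟨ *-cong (+-cong r≈u r⁻¹≈v) (≈-refl {½}) ⟩
        (u + v) * ½           ≡⟨ cong (_* ½) u+v≡2x ⟩
        + 2 * + x * ½         ≡⟨ regroup (+ x) ½ ⟩
        + x * (½ * + 2)       ≈⟨ *-cong (≈-refl {+ x}) ½*2≈1 ⟩
        + x * + 1             ≡⟨ *-identityʳ (+ x) ⟩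
        + x                   ∎
        where
        open ≈-Reasoning
        regroup : ∀ a b → + 2 * a * b ≡ a * (b * + 2)
        regroup a b = solve (a ∷ b ∷ [])

    only-preimages : ∀ u → u ℕ.< N → V u × joukowski u ≡ x → u ≡ residue u₀ ⊎ u ≡ residue u₁
    only-preimages u u<N ((unit-u , _) , fu≡x) =
      Sum.map (≈⇒≡residue u<N) (≈⇒≡residue u<N) (roots-of-product {u₀} {u₁} {+ u} Unit-u₀-u₁ product≈0)
      where
      factorise : ∀ U C X I Y → (U - (X + I * Y)) * (U - (X - I * Y)) - +0
        ≡ ((X + I * Y) * (X - I * Y) - + 1) * + 1 + (C * U - + 1) * - + 1 + (+ 2 * X - (U + C)) * - U
      factorise U C X I Y = solve (U ∷ C ∷ X ∷ I ∷ Y ∷ [])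
      product≈0 : (+ u - u₀) * (+ u - u₁) ≈ +0
      product≈0 = ≈-lincomb₃ u₀u₁≈1 (inv-*ˡ unit-u) (2*joukowski fu≡x) _ _ _ (factorise (+ u) (inv (+ u)) (+ x) i y)

    count-preimages : count N (λ u → V? u ×-dec (joukowski u ≟ x)) ≡ 2
    count-preimages = count-pair (λ u → V? u ×-dec (joukowski u ≟ x)) N (residue<m u₀) (residue<m u₁)
      (Unit-diff⇒residue≢ {u₀} {u₁} Unit-u₀-u₁)
      (preimage {u₀} {u₁} u₀u₁≈1 Unit-u₀-u₁ (sum (+ x) i y))
      (preimage {u₁} {u₀} u₁u₀≈1 Unit-u₁-u₀ (trans (+-comm u₁ u₀) (sum (+ x) i y)))
      only-preimages
      where
      sum : ∀ X I Y → (X + I * Y) + (X - I * Y) ≡ + 2 * X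
      sum X I Y = solve (X ∷ I ∷ Y ∷ [])

  count-V≡2*count-A : count N V? ≡ 2 ℕ.* count N A?
  count-V≡2*count-A = begin
    count N V?                                                   ≡⟨ count-fibres V? N joukowski (λ u _ → residue<m ((+ u + inv (+ u)) * ½)) ⟩
    ∑< N (λ x → count N (λ u → V? u ×-dec (joukowski u ≟ x)))    ≡⟨ ∑<-cong N (λ x x<N → fibre x<N (A? x)) ⟩
    ∑< N (λ x → 2 ℕ.* 𝟙 (A? x))                                  ≡⟨ ∑<-*ˡ N 2 (λ x → 𝟙 (A? x)) ⟩
    2 ℕ.* count N A?                                             ∎
    where
    open ≡-Reasoning
    fibre : ∀ {x} → x ℕ.< N → (d : Dec (A x)) → count N (λ u → V? u ×-dec (joukowski u ≟ x)) ≡ 2 ℕ.* 𝟙 d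
    fibre x<N (yes Ax) = Preimages.count-preimages x<N Ax
    fibre {x} _ (no ¬Ax) = count-none (λ u → V? u ×-dec (joukowski u ≟ x)) N (λ u _ (Vu , fu≡x) → ¬Ax (V⇒A Vu fu≡x))

  Vℤ-respₚ : ∀ {a b} → a Modp.≈ b → Vℤ a → Vℤ b
  Vℤ-respₚ {a} {b} a≈b (unit-a , unit-a²+1 , unit-a²-1) =
    Unit-respₚ a≈b unit-a ,
    Unit-respₚ (Modp.+-cong (Modp.*-cong a≈b a≈b) (Modp.≈-refl {+ 1})) unit-a²+1 ,
    Unit-respₚ (Modp.+-cong (Modp.*-cong a≈b a≈b) (Modp.≈-refl { - + 1})) unit-a²-1

  root : ℕ → ℤ
  root 0 = +0
  root 1 = + 1
  root 2 = - + 1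
  root 3 = i
  root _ = - i

  Unit-[1-i][1+i] : Unit ((+ 1 - i) * (+ 1 + i))
  Unit-[1-i][1+i] = Unit-resp (≈-sym (≈-lincomb₁ i²≈-1 (- + 1) (conjugates i))) Unit-2
    where
    conjugates : ∀ I → (+ 1 - I) * (+ 1 + I) - + 2 ≡ (I * I - - + 1) * - + 1
    conjugates I = solve (I ∷ [])

  Unit-1-i : Unit (+ 1 - i)
  Unit-1-i = Unit-*ˡ {+ 1 - i} {+ 1 + i} Unit-[1-i][1+i]

  Unit-1+i : Unit (+ 1 + i)
  Unit-1+i = Unit-*ʳ {+ 1 - i} {+ 1 + i} Unit-[1-i][1+i]

  Unit-root-difference : ∀ {j k} → j ℕ.< k → k ℕ.< 5 → Unit (root j - root k)
  Unit-root-difference {0} {1} _ _ = Unit-neg Unit-1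
  Unit-root-difference {0} {2} _ _ = Unit-1
  Unit-root-difference {1} {2} _ _ = Unit-2
  Unit-root-difference {0} {3} _ _ = subst Unit (sym (+-identityˡ (- i))) (Unit-neg Unit-i)
  Unit-root-difference {1} {3} _ _ = Unit-1-i
  Unit-root-difference {2} {3} _ _ = subst Unit (neg-distrib-+ (+ 1) i) (Unit-neg Unit-1+i)
  Unit-root-difference {0} {4} _ _ = subst Unit (sym (trans (+-identityˡ (- - i)) (neg-involutive i))) Unit-i
  Unit-root-difference {1} {4} _ _ = subst Unit (sym (cong (λ w → + 1 + w) (neg-involutive i))) Unit-1+i
  Unit-root-difference {2} {4} _ _ = subst Unit (neg-distrib-+ (+ 1) (- i)) (Unit-neg Unit-1-i)
  Unit-root-difference {3} {4} _ _ = Unit-a-[-a] Unit-i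
  Unit-root-difference {_} {0} () _
  Unit-root-difference {suc _} {1} (ℕ.s≤s ()) _
  Unit-root-difference {suc (suc _)} {2} (ℕ.s≤s (ℕ.s≤s ())) _
  Unit-root-difference {suc (suc (suc _))} {3} (ℕ.s≤s (ℕ.s≤s (ℕ.s≤s ()))) _
  Unit-root-difference {suc (suc (suc (suc _)))} {4} (ℕ.s≤s (ℕ.s≤s (ℕ.s≤s (ℕ.s≤s ())))) _
  Unit-root-difference {_} {suc (suc (suc (suc (suc _))))} _ (ℕ.s≤s (ℕ.s≤s (ℕ.s≤s (ℕ.s≤s (ℕ.s≤s ())))))

  excluded : ℕ → ℕ
  excluded j = Modp.residue (root j)

  excluded-injective : ∀ j k → j ℕ.< 5 → k ℕ.< 5 → excluded j ≡ excluded k → j ≡ k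
  excluded-injective j k j<5 k<5 eq with ℕ.<-cmp j k
  ... | tri< j<k _ _ = contradiction eq (Unit-diff⇒residueₚ≢ {root j} {root k} (Unit-root-difference j<k k<5))
  ... | tri≈ _ j≡k _ = j≡k
  ... | tri> _ _ k<j = contradiction (sym eq) (Unit-diff⇒residueₚ≢ {root k} {root j} (Unit-root-difference k<j j<5))

  ¬Vℤ-root : ∀ j → j ℕ.< 5 → ¬ Vℤ (root j)
  ¬Vℤ-root 0 _ (unit-0 , _) = unit-0 p∣0
  ¬Vℤ-root 1 _ (_ , _ , unit-0) = unit-0 p∣0
  ¬Vℤ-root 2 _ (_ , _ , unit-0) = unit-0 p∣0
  ¬Vℤ-root 3 _ (_ , unit-i²+1 , _) = unit-i²+1 p∣i²+1
  ¬Vℤ-root 4 _ (_ , unit-[-i]²+1 , _) = unit-[-i]²+1 (subst (+ p ∣_) (square-neg i) p∣i²+1)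
    where
    square-neg : ∀ I → I * I + + 1 ≡ (- I) * (- I) + + 1
    square-neg I = solve (I ∷ [])
  ¬Vℤ-root (suc (suc (suc (suc (suc _))))) (ℕ.s≤s (ℕ.s≤s (ℕ.s≤s (ℕ.s≤s (ℕ.s≤s ()))))) _

  ¬V⇒excluded : ∀ r → r ℕ.< p → ¬ V r → ∃ λ j → j ℕ.< 5 × r ≡ excluded j
  ¬V⇒excluded r r<p ¬Vr = by-p∣r (+ p ∣? R)
    where
    R = + r
    Excluded = ∃ λ j → j ℕ.< 5 × r ≡ excluded j
    excluded-at : ∀ j → j ℕ.< 5 → + p ∣ R - root j → Excluded
    excluded-at j j<5 p∣r-root = j , j<5 , Modp.≈⇒≡residue {z = root j} r<p (Modp.mk≈ p∣r-root)
    factorise-r²-1 : ∀ X → X * X - + 1 ≡ (X - + 1) * (X + + 1)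
    factorise-r²-1 X = solve (X ∷ [])
    factorise-r²+1 : ∀ X I → (X * X + + 1) - (I * I + + 1) ≡ (X - I) * (X - - I)
    factorise-r²+1 X I = solve (X ∷ I ∷ [])
    by-p∣r²-1 : Unit R → Unit (R * R + + 1) → Dec (+ p ∣ R * R - + 1) → Excluded
    by-p∣r²-1 unit-r unit-r²+1 (no unit-r²-1) = contradiction (unit-r , unit-r²+1 , unit-r²-1) ¬Vr
    by-p∣r²-1 _ _ (yes p∣r²-1) =
      [ excluded-at 1 (ℕ.s≤s (ℕ.s≤s ℕ.z≤n)) , excluded-at 2 (ℕ.s≤s (ℕ.s≤s (ℕ.s≤s ℕ.z≤n))) ]′
        (p∣*⇒ {R - + 1} {R + + 1} (subst (+ p ∣_) (factorise-r²-1 R) p∣r²-1))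
    by-p∣r²+1 : Unit R → Dec (+ p ∣ R * R + + 1) → Excluded
    by-p∣r²+1 unit-r (no unit-r²+1) = by-p∣r²-1 unit-r unit-r²+1 (+ p ∣? (R * R - + 1))
    by-p∣r²+1 _ (yes p∣r²+1) =
      [ excluded-at 3 (ℕ.s≤s (ℕ.s≤s (ℕ.s≤s (ℕ.s≤s ℕ.z≤n)))) , excluded-at 4 ℕ.≤-refl ]′
        (p∣*⇒ {R - i} {R - - i} (subst (+ p ∣_) (factorise-r²+1 R i) (∣m∣n⇒∣m-n p∣r²+1 p∣i²+1)))
    by-p∣r : Dec (+ p ∣ R) → Excluded
    by-p∣r (yes p∣r) = excluded-at 0 ℕ.z<s (subst (+ p ∣_) (sym (+-identityʳ R)) p∣r)
    by-p∣r (no unit-r) = by-p∣r²+1 unit-r (+ p ∣? (R * R + + 1))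

  count-V-mod-p : count p V? ≡ p ℕ.∸ 5
  count-V-mod-p = trans (sym (ℕ.m+n∸n≡m (count p V?) 5)) (cong (ℕ._∸ 5) (count-avoiding V? p 5 excluded
    (λ j _ → Modp.residue<m (root j)) excluded-injective
    (λ j j<5 → ¬Vℤ-root j j<5 ∘ Vℤ-respₚ (Modp.residue≈ (root j))) ¬V⇒excluded))

  count-V : count N V? ≡ p ℕ.^ e ℕ.* (p ℕ.∸ 5)
  count-V = trans (count-periodic V? p (p ℕ.^ e) (λ x → Vℤ-respₚ (≈ₚ-%p x)) (λ x → Vℤ-respₚ (Modp.≈-sym (≈ₚ-%p x))))
                  (cong (p ℕ.^ e ℕ.*_) count-V-mod-p)

  oneMinusSq≡toFin : ∀ j → oneMinusSq N j ≡ toFin (+ 1 - + toℕ j * + toℕ j)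
  oneMinusSq≡toFin j = trans (toℕ-injective (trans (toℕ-fromℕ< _) (sym (toℕ-fromℕ< _)))) (toFin-cong m≈1-x²)
    where
    x = toℕ j
    m = (N ℕ.* N ℕ.+ 1) ℕ.∸ x ℕ.* x
    x²≤N²+1 : x ℕ.* x ℕ.≤ N ℕ.* N ℕ.+ 1
    x²≤N²+1 = ℕ.≤-trans (ℕ.*-mono-≤ (ℕ.<⇒≤ (toℕ<n j)) (ℕ.<⇒≤ (toℕ<n j))) (ℕ.m≤m+n (N ℕ.* N) 1)
    shift : ∀ M X → (M * M + + 1 - X * X) - (+ 1 - X * X) ≡ M * M
    shift M X = solve (M ∷ X ∷ [])
    m≈1-x² : + m ≈ + 1 - + x * + x
    m≈1-x² = ≈-by-multiple (+ N) (begin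
      + m - (+ 1 - + x * + x)                         ≡⟨ cong (_- (+ 1 - + x * + x)) (sym (⊖-≥ x²≤N²+1)) ⟩
      (N ℕ.* N ℕ.+ 1) ⊖ x ℕ.* x - (+ 1 - + x * + x)   ≡⟨ cong (_- (+ 1 - + x * + x)) ([+m]-[+n]≡m⊖n (N ℕ.* N ℕ.+ 1) (x ℕ.* x)) ⟨
      + (N ℕ.* N ℕ.+ 1) - + (x ℕ.* x) - (+ 1 - + x * + x)  ≡⟨ cong₂ (λ a b → a - b - (+ 1 - + x * + x))
                                                                    (trans (pos-+ (N ℕ.* N) 1) (cong (_+ + 1) (pos-* N N))) (pos-* x x) ⟩
      + N * + N + + 1 - + x * + x - (+ 1 - + x * + x) ≡⟨ shift (+ N) (+ x) ⟩
      + N * + N                                       ∎)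
      where open ≡-Reasoning

  countSet≡count-A : countSet N p χ ≡ count N A?
  countSet≡count-A = length-filter-allFin N _ A?
    (λ j (p∤j , p∤1-j² , χ≡1) → p∤j ∘ ∣⇒∣ᵤ , ¬∣residue⇒Unit (subst (λ k → ¬ p ℕ.∣ k) (toℕ-1-j² j) p∤1-j²) ,
                                 trans (cong χ (sym (oneMinusSq≡toFin j))) χ≡1)
    (λ j (unit-j , unit-1-j² , χ≡1) → unit-j ∘ ∣ᵤ⇒∣ , subst (λ k → ¬ p ℕ.∣ k) (sym (toℕ-1-j² j)) (p∤residue unit-1-j²) ,
                                      trans (cong χ (oneMinusSq≡toFin j)) χ≡1)
    where
    toℕ-1-j² : ∀ j → toℕ (oneMinusSq N j) ≡ residue (+ 1 - + toℕ j * + toℕ j)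
    toℕ-1-j² j = trans (cong toℕ (oneMinusSq≡toFin j)) (toℕ-fromℕ< _)

  count-A : 2 ℕ.* count N A? ≡ p ℕ.^ e ℕ.* (p ℕ.∸ 5)
  count-A = trans (sym count-V≡2*count-A) count-V

open import Data.Nat using (ℕ; _*_; _∸_; _^_; _%_; _≥_; NonZero)
open import Data.Nat using (zero; suc)
open import Data.Nat.Primality using (Prime)
open import Data.Fin using (Fin)
open import Data.Integer using (ℤ)
open import Relation.Binary.PropositionalEquality using (_≡_; trans; cong)
open import Defs

lemma2p9 : (p α : ℕ) → Prime p → p % 4 ≡ 1 → α ≥ 1 →
    {{_ : NonZero (p ^ α)}} →
    (χ : Fin (p ^ α) → ℤ) → IsDirichletCharacter (p ^ α) χ → HasOrder2 (p ^ α) χ →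
    2 * countSet (p ^ α) p χ ≡ p ^ (α ∸ 1) * (p ∸ 5)
lemma2p9 p zero _ _ () _ _ _
lemma2p9 p (suc e) p-prime p≡1[4] _ χ χ-character χ-order2 = trans (cong (2 *_) countSet≡count-A) count-A
  where open Parametrisation p e p-prime p≡1[4] χ χ-character χ-order2
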